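{- For a path $P_n$ of order $n>2$, \[\operatorname{ept}(P_n)=\begin{cases}\frac n2+\frac23 & \text{if } n \text{ is even},\\ \frac n2+\frac12 & \text{if } n \text{ is odd}.\end{cases}\]
   Context: Probabilistic zero forcing on a graph $G$: vertices are colored blue or white. The process proceeds in rounds $1,2,3,\dots$. In a round, let $B$ be the set of blue vertices at the start of the round; each blue vertex $u$ fires at each of its white neighbors $w$, and each such fire succeeds independently with probability $|N[u]\cap B|/\deg u$, where $N[u]$ is the closed neighborhood of $u$. At the end of the round, every white vertex at which at least one fire succeeded becomes blue. For a connected graph $G$ and nonempty $Z\subseteq V(G)$, $\mathrm{pt}_{\rm pzf}(G,Z)$ is the random variable equal to the number of the round in which the last white vertex turns blue when starting with exactly $Z$ blue; $\operatorname{ept}(G,Z)=\mathbf{E}[\mathrm{pt}_{\rm pzf}(G,Z)]$ and $\operatorname{ept}(G)=\min_{v\in V(G)}\operatorname{ept}(G,\{v\})$. -}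

module Defs where

open import Data.Bool using (Bool; true; false; if_then_else_; _∧_; _∨_)
open import Data.Nat as ℕ using (ℕ; zero; suc; _≡ᵇ_)
open import Data.Integer using (+_)
open import Data.Fin using (Fin; toℕ; _≟_)
import Data.Fin as F
open import Data.Vec using (Vec; []; _∷_; lookup; tabulate; toList)
open import Data.List as L using (List; []; _∷_; allFin; concatMap; foldr)
open import Data.Product using (_×_; _,_; ∃)
open import Data.Rational using (ℚ; _/_; 0ℚ; 1ℚ; _+_; _*_; _-_; _≤_; _<_; ∣_∣)
open import Relation.Nullary.Decidable using (⌊_⌋)

Adj : ℕ → Set
Adj n = Fin n → Fin n → Bool

pathAdj : (n : ℕ) → Adj n
pathAdj n i j = (toℕ i ≡ᵇ suc (toℕ j)) ∨ (toℕ j ≡ᵇ suc (toℕ i))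

-- A set of blue vertices.
Coloring : ℕ → Set
Coloring n = Fin n → Bool

b2n : Bool → ℕ
b2n true = 1
b2n false = 0

sumℕ : List ℕ → ℕ
sumℕ = foldr ℕ._+_ 0

sumℚ : List ℚ → ℚ
sumℚ = foldr _+_ 0ℚ

prodℚ : List ℚ → ℚ
prodℚ = foldr _*_ 1ℚ

deg : {n : ℕ} → Adj n → Fin n → ℕ
deg {n} adj u = sumℕ (L.map (λ j → b2n (adj u j)) (allFin n))

closedBlue : {n : ℕ} → Adj n → Coloring n → Fin n → ℕ
closedBlue {n} adj B u = b2n (B u) ℕ.+ sumℕ (L.map (λ j → b2n (adj u j ∧ B j)) (allFin n))

-- a / d as a rational (d = 0 only for isolated vertices, which never fire)
frac : ℕ → ℕ → ℚ
frac a zero = 0ℚ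
frac a (suc d) = (+ a) / suc d

fireProb : {n : ℕ} → Adj n → Coloring n → Fin n → ℚ
fireProb adj B u = frac (closedBlue adj B u) (deg adj u)

-- probability that vertex w is blue at the end of the round
-- (1 if already blue; otherwise 1 - ∏ over blue neighbours u of (1 - fireProb u),
--  the fires being independent)
blueProb : {n : ℕ} → Adj n → Coloring n → Fin n → ℚ
blueProb {n} adj B w with B w
... | true = 1ℚ
... | false = 1ℚ - prodℚ (L.map (λ u → if adj u w ∧ B u then 1ℚ - fireProb adj B u else 1ℚ) (allFin n))

-- product distribution of independent Bernoulli(q i) coordinates, as a weighted list
outcomes : (m : ℕ) → (Fin m → ℚ) → List (Vec Bool m × ℚ)
outcomes zero q = ([] , 1ℚ) ∷ []
outcomes (suc m) q =
  concatMap (λ { (v , p) → (true ∷ v , q F.zero * p) ∷ (false ∷ v , (1ℚ - q F.zero) * p) ∷ [] })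
            (outcomes m (λ i → q (F.suc i)))


step : {n : ℕ} → Adj n → List (Vec Bool n × ℚ) → List (Vec Bool n × ℚ)
step {n} adj =
  concatMap (λ { (B , p) → L.map (λ { (B' , p') → (B' , p * p') }) (outcomes n (blueProb adj (lookup B))) })

distAfter : {n : ℕ} → Adj n → Vec Bool n → ℕ → List (Vec Bool n × ℚ)
distAfter adj Z zero = (Z , 1ℚ) ∷ []
distAfter adj Z (suc k) = step adj (distAfter adj Z k)

allBlue : {n : ℕ} → Vec Bool n → Bool
allBlue v = foldr _∧_ true (toList v)

probNotDone : {n : ℕ} → Adj n → Vec Bool n → ℕ → ℚ
probNotDone adj Z k =
  sumℚ (L.map (λ { (B , p) → if allBlue B then 0ℚ else p }) (distAfter adj Z k))

-- partial sums Σ_{k<m} P(pt > k); E[pt] = lim_m of these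
partialEpt : {n : ℕ} → Adj n → Vec Bool n → ℕ → ℚ
partialEpt adj Z zero = 0ℚ
partialEpt adj Z (suc m) = partialEpt adj Z m + probNotDone adj Z m

singleton : {n : ℕ} → Fin n → Vec Bool n
singleton v = tabulate (λ i → ⌊ i ≟ v ⌋)

ConvergesTo : (ℕ → ℚ) → ℚ → Set
ConvergesTo s L = ∀ ε → 0ℚ < ε → ∃ λ N → ∀ m → N ℕ.≤ m → ∣ s m - L ∣ ≤ ε

-- the (nondecreasing) sequence s has limit ≥ L (possibly +∞)
EventuallyAtLeast : (ℕ → ℚ) → ℚ → Set
EventuallyAtLeast s L = ∀ ε → 0ℚ < ε → ∃ λ N → ∀ m → N ℕ.≤ m → L - ε ≤ s m

EptFrom≡ : {n : ℕ} → Adj n → Vec Bool n → ℚ → Set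
EptFrom≡ adj Z L = ConvergesTo (partialEpt adj Z) L

-- ept(G) = min_v ept(G,{v}) = L : attained at some v, and no v gives a smaller value
Ept≡ : {n : ℕ} → Adj n → ℚ → Set
Ept≡ {n} adj L =
  (∃ λ (v : Fin n) → EptFrom≡ adj (singleton v) L)
  × (∀ (v : Fin n) → EventuallyAtLeast (partialEpt adj (singleton v)) L)

module Submission where

-- On a path the blue set is always an interval [a, b]. Once every endpoint of the interval has at
-- most one white neighbour (it has two vertices or touches an end of the path), each endpoint fires
-- with probability 1, so the interval grows deterministically and exactly max(a, n - 1 - b) rounds
-- remain; from an end vertex this is n - 1. From an interior vertex the first round colours each
-- neighbour independently with probability 1/2; three of the four outcomes grow deterministically
-- and the fourth is the starting position, so the expected time L satisfies L = 1 + (L + c) / 4,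
-- i.e. 6L = 8 + 2c, where c is the total remaining time of the three growing outcomes. Always
-- 8 + 2c ≥ 3n + 3, with equality at the middle vertex for odd n; for even n parity forces
-- 8 + 2c ≥ 3n + 4, attained at a central vertex. Expectations are limits of the partial sums of
-- P(pt > k), which are eventually constant or satisfy an affine recurrence with ratio 1/4.

open import Defs
open import Data.Bool using (Bool; true; false; if_then_else_; _∧_; _∨_; not)
open import Data.Empty using (⊥-elim)
open import Data.Fin as F using (Fin; toℕ)
import Data.Fin.Properties as FP
open import Data.List as L using (List; []; _∷_; _++_; allFin)
open import Data.Nat as ℕ using (ℕ; zero; suc; z≤n; s≤s)
import Data.Nat.Properties as ℕP
open import Data.Product using (_×_; _,_; ∃; ∃₂; proj₁; proj₂)
open import Data.Sum using (_⊎_; inj₁; inj₂)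
open import Data.Vec as V using (Vec; []; _∷_; lookup)
import Data.Vec.Properties as VP
open import Function using (_∘_; const; id)
open import Relation.Binary.Definitions using (tri<; tri≈; tri>)
open import Relation.Binary.PropositionalEquality
open import Relation.Nullary using (yes; no)

module Limits where

  open import Data.Integer as ℤ using (+_; -[1+_])
  import Data.Integer.Properties as ℤP
  open import Data.Maybe using (Maybe; just; nothing)
  open import Data.Nat using (_^_)
  open import Data.Rational
    using (ℚ; mkℚ; 0ℚ; 1ℚ; _+_; _*_; _-_; -_; _/_; _≤_; _<_; *≤*; NonNegative; NonZero; positive; 1/_; ∣_∣)
  open import Data.Rational.Literals using (fromℤ)
  open import Data.Rational.Properties
  open import Tactic.RingSolver
  open import Tactic.RingSolver.Core.AlmostCommutativeRing using (AlmostCommutativeRing; fromCommutativeRing)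

  ½ ¼ ⅙ : ℚ
  ½ = + 1 / 2
  ¼ = + 1 / 4
  ⅙ = + 1 / 6

  ℚ-ring : AlmostCommutativeRing _ _
  ℚ-ring = fromCommutativeRing +-*-commutativeRing isZero
    where
    isZero : ∀ x → Maybe (0ℚ ≡ x)
    isZero x with 0ℚ ≟ x
    ... | yes p = just p
    ... | no _ = nothing

  fromℕ : ℕ → ℚ
  fromℕ k = fromℤ (+ k)

  fromℕ-suc : ∀ k → fromℕ (suc k) ≡ fromℕ k + 1ℚ
  fromℕ-suc k = sym (trans (cong (λ z → (z ℤ.+ + 1) / 1) (ℤP.*-identityʳ (+ k)))
                    (trans (normalize-coprime _) (cong fromℕ (ℕP.+-comm k 1))))

  fromℕ-+ : ∀ a b → fromℕ (a ℕ.+ b) ≡ fromℕ a + fromℕ b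
  fromℕ-+ zero b = sym (+-identityˡ (fromℕ b))
  fromℕ-+ (suc a) b = begin
      fromℕ (suc (a ℕ.+ b))      ≡⟨ fromℕ-suc (a ℕ.+ b) ⟩
      fromℕ (a ℕ.+ b) + 1ℚ       ≡⟨ cong (_+ 1ℚ) (fromℕ-+ a b) ⟩
      fromℕ a + fromℕ b + 1ℚ     ≡⟨ shuffle (fromℕ a) (fromℕ b) ⟩
      fromℕ a + 1ℚ + fromℕ b     ≡⟨ cong (_+ fromℕ b) (sym (fromℕ-suc a)) ⟩
      fromℕ (suc a) + fromℕ b    ∎
    where
    open ≡-Reasoning
    shuffle : ∀ x y → x + y + 1ℚ ≡ x + 1ℚ + y
    shuffle = solve-∀ ℚ-ring

  fromℕ-* : ∀ a b → fromℕ (a ℕ.* b) ≡ fromℕ a * fromℕ b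
  fromℕ-* zero b = sym (*-zeroˡ (fromℕ b))
  fromℕ-* (suc a) b = begin
      fromℕ (b ℕ.+ a ℕ.* b)          ≡⟨ fromℕ-+ b (a ℕ.* b) ⟩
      fromℕ b + fromℕ (a ℕ.* b)      ≡⟨ cong (λ z → fromℕ b + z) (fromℕ-* a b) ⟩
      fromℕ b + fromℕ a * fromℕ b    ≡⟨ factor (fromℕ a) (fromℕ b) ⟩
      (fromℕ a + 1ℚ) * fromℕ b       ≡⟨ cong (_* fromℕ b) (sym (fromℕ-suc a)) ⟩
      fromℕ (suc a) * fromℕ b        ∎
    where
    open ≡-Reasoning
    factor : ∀ x y → y + x * y ≡ (x + 1ℚ) * y
    factor = solve-∀ ℚ-ring

  /6≡fromℕ*⅙ : ∀ x → (+ x) / 6 ≡ fromℕ x * ⅙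
  /6≡fromℕ*⅙ x = sym (cong (_/ 6) (ℤP.*-identityʳ (+ x)))

  fromℕ-mono-≤ : ∀ {a b} → a ℕ.≤ b → fromℕ a ≤ fromℕ b
  fromℕ-mono-≤ {a} {b} a≤b =
    *≤* (subst₂ ℤ._≤_ (sym (ℤP.*-identityʳ (+ a))) (sym (ℤP.*-identityʳ (+ b))) (ℤ.+≤+ a≤b))

  /6-mono-≤ : ∀ {x y} → x ℕ.≤ y → (+ x) / 6 ≤ (+ y) / 6
  /6-mono-≤ {x} {y} x≤y =
    subst₂ _≤_ (sym (/6≡fromℕ*⅙ x)) (sym (/6≡fromℕ*⅙ y)) (*-monoʳ-≤-nonNeg ⅙ (fromℕ-mono-≤ x≤y))

  fromℕ≡6*/6 : ∀ k → fromℕ k ≡ (+ (6 ℕ.* k)) / 6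
  fromℕ≡6*/6 k = sym (begin
      (+ (6 ℕ.* k)) / 6        ≡⟨ /6≡fromℕ*⅙ (6 ℕ.* k) ⟩
      fromℕ (6 ℕ.* k) * ⅙      ≡⟨ cong (_* ⅙) (fromℕ-* 6 k) ⟩
      fromℕ 6 * fromℕ k * ⅙    ≡⟨ cancel (fromℕ k) ⟩
      fromℕ k                  ∎)
    where
    open ≡-Reasoning
    cancel : ∀ x → fromℕ 6 * x * ⅙ ≡ x
    cancel = solve-∀ ℚ-ring

  ≤-fromℕ : ∀ p → ∃ λ k → p ≤ fromℕ k
  ≤-fromℕ p@(mkℚ (+ k) d _) =
    k , *≤* (subst₂ ℤ._≤_ (sym (ℤP.*-identityʳ (+ k))) (ℤP.pos-* k (suc d)) (ℤ.+≤+ (ℕP.m≤m*n k (suc d))))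
  ≤-fromℕ p@(mkℚ -[1+ k ] d _) = 0 , <⇒≤ (negative⁻¹ p)

  archimedean : ∀ x ε → 0ℚ < ε → ∃ λ k → x ≤ ε * fromℕ k
  archimedean x ε ε>0 = k , (begin
      x                    ≡⟨ sym (trans (*-assoc x (1/ ε) ε) (trans (cong (x *_) (*-inverseˡ ε)) (*-identityʳ x))) ⟩
      x * 1/ ε * ε         ≤⟨ *-monoʳ-≤-nonNeg ε (proj₂ (≤-fromℕ (x * 1/ ε))) ⟩
      fromℕ k * ε          ≡⟨ *-comm (fromℕ k) ε ⟩
      ε * fromℕ k          ∎)
    where
    open ≤-Reasoning
    instance
      ε-nonZero : NonZero ε
      ε-nonZero = pos⇒nonZero ε {{positive ε>0}}
      ε-nonNeg : NonNegative ε
      ε-nonNeg = pos⇒nonNeg ε {{positive ε>0}}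
    k = proj₁ (≤-fromℕ (x * 1/ ε))

  p≤∣p∣ : ∀ p → p ≤ ∣ p ∣
  p≤∣p∣ p@(mkℚ (+ _) _ _) = ≤-refl
  p≤∣p∣ p@(mkℚ -[1+ _ ] _ _) = ≤-trans (<⇒≤ (negative⁻¹ p)) (0≤∣p∣ p)

  converges-eventuallyConstant : ∀ (s : ℕ → ℚ) R L → (∀ m → R ℕ.≤ m → s m ≡ L) → ConvergesTo s L
  converges-eventuallyConstant s R L const ε ε>0 = R , λ m R≤m →
    subst (λ t → ∣ t - L ∣ ≤ ε) (sym (const m R≤m))
          (subst (_≤ ε) (sym (cong ∣_∣ (+-inverseʳ L))) (<⇒≤ ε>0))

  converges⇒eventuallyAtLeast : ∀ (s : ℕ → ℚ) {L′} L → ConvergesTo s L′ → L ≤ L′ → EventuallyAtLeast s L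
  converges⇒eventuallyAtLeast s {L′} L conv L≤L′ ε ε>0 with conv ε ε>0
  ... | N , close = N , λ m N≤m → begin
      L - ε                   ≤⟨ +-monoˡ-≤ (- ε) L≤L′ ⟩
      L′ - ε                  ≡⟨ sym (rearrange (s m) L′ ε) ⟩
      (L′ - s m) + (s m - ε)  ≤⟨ +-monoˡ-≤ (s m - ε) (gap m N≤m) ⟩
      ε + (s m - ε)           ≡⟨ cancel (s m) ε ⟩
      s m                     ∎
    where
    open ≤-Reasoning
    rearrange : ∀ x y e → (y - x) + (x - e) ≡ y - e
    rearrange = solve-∀ ℚ-ring
    cancel : ∀ x e → e + (x - e) ≡ x
    cancel = solve-∀ ℚ-ring
    negate : ∀ x y → y - x ≡ - (x - y)
    negate = solve-∀ ℚ-ring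
    gap : ∀ m → N ℕ.≤ m → L′ - s m ≤ ε
    gap m N≤m = begin
      L′ - s m          ≤⟨ p≤∣p∣ (L′ - s m) ⟩
      ∣ L′ - s m ∣      ≡⟨ trans (cong ∣_∣ (negate (s m) L′)) (∣-p∣≡∣p∣ (s m - L′)) ⟩
      ∣ s m - L′ ∣      ≤⟨ close m N≤m ⟩
      ε                 ∎

  1+n≤4^n : ∀ j → suc j ℕ.≤ 4 ^ j
  1+n≤4^n zero = s≤s z≤n
  1+n≤4^n (suc j) = ℕP.≤-trans (ℕP.≤-reflexive (ℕP.+-comm 1 (suc j)))
    (ℕP.+-mono-≤ (1+n≤4^n j) (ℕP.≤-trans (ℕP.≤-trans (s≤s z≤n) (1+n≤4^n j)) (ℕP.m≤m+n (4 ^ j) _)))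

  module _ (s : ℕ → ℚ) (R : ℕ) {α L : ℚ}
           (recurrence : ∀ m → R ℕ.≤ m → s (suc m) ≡ α + ¼ * s m) (fixed : L ≡ α + ¼ * L) where

    private
      e : ℕ → ℚ
      e j = s (j ℕ.+ R) - L

      error-suc : ∀ j → e (suc j) ≡ ¼ * e j
      error-suc j = trans (cong₂ _-_ (recurrence (j ℕ.+ R) (ℕP.m≤n+m R j)) fixed) (factor α ¼ (s (j ℕ.+ R)) L)
        where
        factor : ∀ a q x l → (a + q * x) - (a + q * l) ≡ q * (x - l)
        factor = solve-∀ ℚ-ring

      error-scaled : ∀ j → ∣ e j ∣ * fromℕ (4 ^ j) ≡ ∣ e 0 ∣
      error-scaled zero = *-identityʳ _
      error-scaled (suc j) = begin
          ∣ e (suc j) ∣ * fromℕ (4 ^ suc j)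
        ≡⟨ cong₂ _*_ (trans (cong ∣_∣ (error-suc j)) (∣p*q∣≡∣p∣*∣q∣ ¼ (e j))) (fromℕ-* 4 (4 ^ j)) ⟩
          (¼ * ∣ e j ∣) * (fromℕ 4 * fromℕ (4 ^ j))
        ≡⟨ regroup ¼ (fromℕ 4) ∣ e j ∣ (fromℕ (4 ^ j)) ⟩
          (¼ * fromℕ 4) * (∣ e j ∣ * fromℕ (4 ^ j))
        ≡⟨ trans (*-identityˡ _) (error-scaled j) ⟩
          ∣ e 0 ∣ ∎
        where
        open ≡-Reasoning
        regroup : ∀ q f a p → (q * a) * (f * p) ≡ (q * f) * (a * p)
        regroup = solve-∀ ℚ-ring

      error-small : ∀ ε → 0ℚ < ε → ∀ K → ∣ e 0 ∣ ≤ ε * fromℕ K → ∀ j → K ℕ.≤ j → ∣ e j ∣ ≤ ε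
      error-small ε ε>0 K e₀≤εK j K≤j =
        cancel (4 ^ j) (ℕP.≤-trans (s≤s z≤n) (1+n≤4^n j)) (error-scaled j)
               (ℕP.≤-trans (ℕP.≤-trans K≤j (ℕP.n≤1+n j)) (1+n≤4^n j))
        where
        open ≤-Reasoning
        instance
          ε-nonNeg : NonNegative ε
          ε-nonNeg = pos⇒nonNeg ε {{positive ε>0}}
        cancel : ∀ P → 0 ℕ.< P → ∣ e j ∣ * fromℕ P ≡ ∣ e 0 ∣ → K ℕ.≤ P → ∣ e j ∣ ≤ ε
        cancel (suc k) _ scaled K≤P = *-cancelʳ-≤-pos (fromℕ (suc k)) (begin
          ∣ e j ∣ * fromℕ (suc k)  ≡⟨ scaled ⟩
          ∣ e 0 ∣                  ≤⟨ e₀≤εK ⟩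
          ε * fromℕ K              ≤⟨ *-monoˡ-≤-nonNeg ε (fromℕ-mono-≤ K≤P) ⟩
          ε * fromℕ (suc k)        ∎)

    converges-contraction : ConvergesTo s L
    converges-contraction ε ε>0 with archimedean ∣ e 0 ∣ ε ε>0
    ... | K , e₀≤εK = K ℕ.+ R , λ m K+R≤m →
      subst (λ t → ∣ s t - L ∣ ≤ ε) (ℕP.m∸n+n≡m (ℕP.≤-trans (ℕP.m≤n+m R K) K+R≤m))
        (error-small ε ε>0 K e₀≤εK (m ℕ.∸ R)
          (subst (ℕ._≤ m ℕ.∸ R) (ℕP.m+n∸n≡m K R) (ℕP.∸-monoˡ-≤ R K+R≤m)))

module Process where

  open import Algebra.Bundles using (CommutativeMonoid)
  import Data.Integer as ℤ
  import Data.Integer.Properties as ℤP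
  import Data.List.Properties as LP
  open import Data.Rational using (ℚ; 0ℚ; 1ℚ; _+_; _*_; _-_)
  open import Data.Rational.Properties
  open import Data.Rational.Unnormalised using (*≡*; mkℚᵘ)
  open import Data.Vec.Functional using (updateAt)
  open import Data.Vec.Functional.Properties using (updateAt-updates; updateAt-minimal)
  open import Tactic.RingSolver
  open Limits using (ℚ-ring)

  module _ {c ℓ} (M : CommutativeMonoid c ℓ) where
    open CommutativeMonoid M
      using (Carrier; _≈_; _∙_; ε; ∙-cong; ∙-congˡ; identityˡ; identityʳ; comm; commutativeSemigroup)
      renaming (refl to ≈-refl; sym to ≈-sym; trans to ≈-trans)

    private
      fold : List Carrier → Carrier
      fold = L.foldr _∙_ ε

    fold-tabulate-ε : ∀ {n} (g : Fin n → Carrier) → (∀ k → g k ≈ ε) → fold (L.tabulate g) ≈ ε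
    fold-tabulate-ε {zero} g h = ≈-refl
    fold-tabulate-ε {suc n} g h = ≈-trans (∙-cong (h F.zero) (fold-tabulate-ε (g ∘ F.suc) (h ∘ F.suc))) (identityˡ ε)

    fold-tabulate-single : ∀ {n} (g : Fin n → Carrier) i → (∀ k → k ≢ i → g k ≈ ε) → fold (L.tabulate g) ≈ g i
    fold-tabulate-single g F.zero h =
      ≈-trans (∙-congˡ (fold-tabulate-ε (g ∘ F.suc) (λ k → h (F.suc k) λ ()))) (identityʳ _)
    fold-tabulate-single g (F.suc i) h =
      ≈-trans (∙-cong (h F.zero λ ())
                      (fold-tabulate-single (g ∘ F.suc) i (λ k k≢i → h (F.suc k) (k≢i ∘ FP.suc-injective))))
              (identityˡ _)

    fold-tabulate-pair : ∀ {n} (g : Fin n → Carrier) i j → i ≢ j → (∀ k → k ≢ i → k ≢ j → g k ≈ ε) →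
      fold (L.tabulate g) ≈ g i ∙ g j
    fold-tabulate-pair g F.zero F.zero i≢j h = ⊥-elim (i≢j refl)
    fold-tabulate-pair g F.zero (F.suc j) i≢j h =
      ∙-congˡ (fold-tabulate-single (g ∘ F.suc) j (λ k k≢j → h (F.suc k) (λ ()) (k≢j ∘ FP.suc-injective)))
    fold-tabulate-pair g (F.suc i) F.zero i≢j h =
      ≈-trans (∙-congˡ (fold-tabulate-single (g ∘ F.suc) i (λ k k≢i → h (F.suc k) (k≢i ∘ FP.suc-injective) (λ ()))))
              (comm _ _)
    fold-tabulate-pair g (F.suc i) (F.suc j) i≢j h =
      ≈-trans (∙-cong (h F.zero (λ ()) (λ ()))
                    (fold-tabulate-pair (g ∘ F.suc) i j (i≢j ∘ cong F.suc)
                      (λ k k≢i k≢j → h (F.suc k) (k≢i ∘ FP.suc-injective) (k≢j ∘ FP.suc-injective))))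
            (identityˡ _)

    fold-tabulate-∙ : ∀ {n} (g h : Fin n → Carrier) →
      fold (L.tabulate (λ k → g k ∙ h k)) ≈ fold (L.tabulate g) ∙ fold (L.tabulate h)
    fold-tabulate-∙ {zero} g h = ≈-sym (identityˡ ε)
    fold-tabulate-∙ {suc n} g h =
      ≈-trans (∙-congˡ (fold-tabulate-∙ (g ∘ F.suc) (h ∘ F.suc)))
            (interchange _ _ _ _)
      where
      open import Algebra.Properties.CommutativeSemigroup commutativeSemigroup using (interchange)

  prodℚ-tabulate-zero : ∀ {n} (g : Fin n → ℚ) i → g i ≡ 0ℚ → prodℚ (L.tabulate g) ≡ 0ℚ
  prodℚ-tabulate-zero g F.zero gi≡0 =
    trans (cong (_* prodℚ (L.tabulate (g ∘ F.suc))) gi≡0) (*-zeroˡ (prodℚ (L.tabulate (g ∘ F.suc))))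
  prodℚ-tabulate-zero g (F.suc i) gi≡0 =
    trans (cong (g F.zero *_) (prodℚ-tabulate-zero (g ∘ F.suc) i gi≡0)) (*-zeroʳ (g F.zero))

  expect : {A : Set} → List (A × ℚ) → (A → ℚ) → ℚ
  expect [] f = 0ℚ
  expect ((x , p) ∷ D) f = p * f x + expect D f

  module _ {A : Set} where

    expect-++ : ∀ (D E : List (A × ℚ)) f → expect (D ++ E) f ≡ expect D f + expect E f
    expect-++ [] E f = sym (+-identityˡ _)
    expect-++ ((x , p) ∷ D) E f = trans (cong (p * f x +_) (expect-++ D E f)) (sym (+-assoc (p * f x) _ _))

    expect-cong : ∀ (D : List (A × ℚ)) {f g} → (∀ x → f x ≡ g x) → expect D f ≡ expect D g
    expect-cong [] f≗g = refl
    expect-cong ((x , p) ∷ D) f≗g = cong₂ (λ a b → p * a + b) (f≗g x) (expect-cong D f≗g)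

    -- Stated for any g acting as (x , q) ↦ (x , p * q): the pattern-matching lambda in step is not
    -- definitionally equal to any lambda written here.
    expect-rescale : ∀ (D : List (A × ℚ)) p f (g : A × ℚ → A × ℚ) → (∀ x q → g (x , q) ≡ (x , p * q)) →
      expect (L.map g D) f ≡ p * expect D f
    expect-rescale [] p f g g≡ = sym (*-zeroʳ p)
    expect-rescale ((x , q) ∷ D) p f g g≡ rewrite g≡ x q | expect-rescale D p f g g≡ =
      distrib p q (f x) (expect D f)
      where
      distrib : ∀ p q a e → p * q * a + p * e ≡ p * (q * a + e)
      distrib = solve-∀ ℚ-ring

  roundExpect : ∀ {n} → Adj n → (Vec Bool n → ℚ) → Vec Bool n → ℚ
  roundExpect {n} adj f B = expect (outcomes n (blueProb adj (lookup B))) f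

  afterRounds : ∀ {n} → Adj n → ℕ → (Vec Bool n → ℚ) → Vec Bool n → ℚ
  afterRounds adj zero f = f
  afterRounds adj (suc k) f = roundExpect adj (afterRounds adj k f)

  someWhite : ∀ {n} → Vec Bool n → ℚ
  someWhite B = if allBlue B then 0ℚ else 1ℚ

  module _ {n} (adj : Adj n) where

    expect-step : ∀ D f → expect (step adj D) f ≡ expect D (roundExpect adj f)
    expect-step [] f = refl
    expect-step ((B , p) ∷ D) f = begin
        expect (L.map _ Ω ++ step adj D) f
      ≡⟨ expect-++ (L.map _ Ω) (step adj D) f ⟩
        expect (L.map _ Ω) f + expect (step adj D) f
      ≡⟨ cong₂ _+_ (expect-rescale Ω p f _ (λ _ _ → refl)) (expect-step D f) ⟩
        p * roundExpect adj f B + expect D (roundExpect adj f) ∎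
      where
      open ≡-Reasoning
      Ω = outcomes n (blueProb adj (lookup B))

    afterRounds-roundExpect : ∀ k f B → afterRounds adj k (roundExpect adj f) B ≡ roundExpect adj (afterRounds adj k f) B
    afterRounds-roundExpect zero f B = refl
    afterRounds-roundExpect (suc k) f B = expect-cong (outcomes n _) (afterRounds-roundExpect k f)

    expect-distAfter : ∀ Z k f → expect (distAfter adj Z k) f ≡ afterRounds adj k f Z
    expect-distAfter Z zero f = trans (+-identityʳ _) (*-identityˡ _)
    expect-distAfter Z (suc k) f = begin
        expect (step adj (distAfter adj Z k)) f
      ≡⟨ expect-step (distAfter adj Z k) f ⟩
        expect (distAfter adj Z k) (roundExpect adj f)
      ≡⟨ expect-distAfter Z k (roundExpect adj f) ⟩
        afterRounds adj k (roundExpect adj f) Z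
      ≡⟨ afterRounds-roundExpect k f Z ⟩
        afterRounds adj (suc k) f Z ∎
      where open ≡-Reasoning

    probNotDone≡afterRounds : ∀ Z k → probNotDone adj Z k ≡ afterRounds adj k someWhite Z
    probNotDone≡afterRounds Z k = trans (sum≡expect (distAfter adj Z k)) (expect-distAfter Z k someWhite)
      where
      weight≡ : ∀ (B : Vec Bool n) p → (if allBlue B then 0ℚ else p) ≡ p * someWhite B
      weight≡ B p with allBlue B
      ... | true = sym (*-zeroʳ p)
      ... | false = sym (*-identityʳ p)
      sum≡expect : ∀ D → sumℚ (L.map _ D) ≡ expect D someWhite
      sum≡expect [] = refl
      sum≡expect ((B , p) ∷ D) = cong₂ _+_ (weight≡ B p) (sum≡expect D)

  ind : Bool → ℚ
  ind true = 1ℚ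
  ind false = 0ℚ

  set : ∀ {m} → (Fin m → ℚ) → Fin m → ℚ → Fin m → ℚ
  set q i x = updateAt q i (const x)

  expect-outcomes-suc : ∀ m (q : Fin (suc m) → ℚ) f →
    expect (outcomes (suc m) q) f ≡
      q F.zero * expect (outcomes m (q ∘ F.suc)) (f ∘ (true ∷_))
      + (1ℚ - q F.zero) * expect (outcomes m (q ∘ F.suc)) (f ∘ (false ∷_))
  expect-outcomes-suc m q f = go _ (λ _ _ → refl) (outcomes m (q ∘ F.suc))
    where
    c = q F.zero
    go : (g : Vec Bool m × ℚ → List (Vec Bool (suc m) × ℚ)) →
         (∀ v p → g (v , p) ≡ (true ∷ v , c * p) ∷ (false ∷ v , (1ℚ - c) * p) ∷ []) →
         ∀ D → expect (L.concatMap g D) f ≡ c * expect D (f ∘ (true ∷_)) + (1ℚ - c) * expect D (f ∘ (false ∷_))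
    go g g≡ [] = sym (trans (cong₂ _+_ (*-zeroʳ c) (*-zeroʳ (1ℚ - c))) (+-identityʳ 0ℚ))
    go g g≡ ((v , p) ∷ D) rewrite g≡ v p | go g g≡ D =
      regroup c (1ℚ - c) p (f (true ∷ v)) (f (false ∷ v)) (expect D (f ∘ (true ∷_))) (expect D (f ∘ (false ∷_)))
      where
      regroup : ∀ c d p x y X Y → c * p * x + (d * p * y + (c * X + d * Y)) ≡ c * (p * x + X) + d * (p * y + Y)
      regroup = solve-∀ ℚ-ring

  expect-outcomes-indicator : ∀ m (q : Fin m → ℚ) f (w : Vec Bool m) → (∀ i → q i ≡ ind (lookup w i)) →
    expect (outcomes m q) f ≡ f w
  expect-outcomes-indicator zero q f [] q≡ = trans (+-identityʳ _) (*-identityˡ _)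
  expect-outcomes-indicator (suc m) q f (x ∷ w) q≡ = begin
      expect (outcomes (suc m) q) f
    ≡⟨ expect-outcomes-suc m q f ⟩
      q F.zero * expect Ω (f ∘ (true ∷_)) + (1ℚ - q F.zero) * expect Ω (f ∘ (false ∷_))
    ≡⟨ cong₂ (λ a b → q F.zero * a + (1ℚ - q F.zero) * b) (rest (f ∘ (true ∷_))) (rest (f ∘ (false ∷_))) ⟩
      q F.zero * f (true ∷ w) + (1ℚ - q F.zero) * f (false ∷ w)
    ≡⟨ cong (λ a → a * f (true ∷ w) + (1ℚ - a) * f (false ∷ w)) (q≡ F.zero) ⟩
      ind x * f (true ∷ w) + (1ℚ - ind x) * f (false ∷ w)
    ≡⟨ select x ⟩
      f (x ∷ w) ∎
    where
    open ≡-Reasoning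
    Ω = outcomes m (q ∘ F.suc)
    rest : ∀ g → expect Ω g ≡ g w
    rest g = expect-outcomes-indicator m (q ∘ F.suc) g w (q≡ ∘ F.suc)
    select : ∀ x → ind x * f (true ∷ w) + (1ℚ - ind x) * f (false ∷ w) ≡ f (x ∷ w)
    select true = pickFirst (f (true ∷ w)) (f (false ∷ w))
      where
      pickFirst : ∀ a b → 1ℚ * a + (1ℚ - 1ℚ) * b ≡ a
      pickFirst = solve-∀ ℚ-ring
    select false = pickSecond (f (true ∷ w)) (f (false ∷ w))
      where
      pickSecond : ∀ a b → 0ℚ * a + (1ℚ - 0ℚ) * b ≡ b
      pickSecond = solve-∀ ℚ-ring

  expect-outcomes-split : ∀ m (q : Fin m → ℚ) f i →
    expect (outcomes m q) f ≡
      q i * expect (outcomes m (set q i 1ℚ)) f + (1ℚ - q i) * expect (outcomes m (set q i 0ℚ)) f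
  expect-outcomes-split (suc m) q f F.zero = begin
      expect (outcomes (suc m) q) f
    ≡⟨ expect-outcomes-suc m q f ⟩
      x * a + (1ℚ - x) * b
    ≡⟨ collapse x a b ⟩
      x * (1ℚ * a + (1ℚ - 1ℚ) * b) + (1ℚ - x) * (0ℚ * a + (1ℚ - 0ℚ) * b)
    ≡⟨ sym (cong₂ (λ c d → x * c + (1ℚ - x) * d)
             (expect-outcomes-suc m (set q F.zero 1ℚ) f) (expect-outcomes-suc m (set q F.zero 0ℚ) f)) ⟩
      x * expect (outcomes (suc m) (set q F.zero 1ℚ)) f + (1ℚ - x) * expect (outcomes (suc m) (set q F.zero 0ℚ)) f ∎
    where
    open ≡-Reasoning
    x = q F.zero
    a = expect (outcomes m (q ∘ F.suc)) (f ∘ (true ∷_))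
    b = expect (outcomes m (q ∘ F.suc)) (f ∘ (false ∷_))
    collapse : ∀ x a b →
      x * a + (1ℚ - x) * b ≡ x * (1ℚ * a + (1ℚ - 1ℚ) * b) + (1ℚ - x) * (0ℚ * a + (1ℚ - 0ℚ) * b)
    collapse = solve-∀ ℚ-ring
  expect-outcomes-split (suc m) q f (F.suc i) = begin
      expect (outcomes (suc m) q) f
    ≡⟨ expect-outcomes-suc m q f ⟩
      x * expect (outcomes m q′) f₁ + (1ℚ - x) * expect (outcomes m q′) f₀
    ≡⟨ cong₂ (λ c d → x * c + (1ℚ - x) * d)
             (expect-outcomes-split m q′ f₁ i) (expect-outcomes-split m q′ f₀ i) ⟩
      x * (y * E₁ f₁ + (1ℚ - y) * E₀ f₁) + (1ℚ - x) * (y * E₁ f₀ + (1ℚ - y) * E₀ f₀)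
    ≡⟨ swap x y (E₁ f₁) (E₀ f₁) (E₁ f₀) (E₀ f₀) ⟩
      y * (x * E₁ f₁ + (1ℚ - x) * E₁ f₀) + (1ℚ - y) * (x * E₀ f₁ + (1ℚ - x) * E₀ f₀)
    ≡⟨ sym (cong₂ (λ c d → y * c + (1ℚ - y) * d)
             (expect-outcomes-suc m (set q (F.suc i) 1ℚ) f) (expect-outcomes-suc m (set q (F.suc i) 0ℚ) f)) ⟩
      y * expect (outcomes (suc m) (set q (F.suc i) 1ℚ)) f
        + (1ℚ - y) * expect (outcomes (suc m) (set q (F.suc i) 0ℚ)) f ∎
    where
    open ≡-Reasoning
    x = q F.zero
    q′ = q ∘ F.suc
    y = q′ i
    f₁ = f ∘ (true ∷_)
    f₀ = f ∘ (false ∷_)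
    E₁ E₀ : (Vec Bool m → ℚ) → ℚ
    E₁ g = expect (outcomes m (set q′ i 1ℚ)) g
    E₀ g = expect (outcomes m (set q′ i 0ℚ)) g
    swap : ∀ x y a b c d → x * (y * a + (1ℚ - y) * b) + (1ℚ - x) * (y * c + (1ℚ - y) * d)
                         ≡ y * (x * a + (1ℚ - x) * c) + (1ℚ - y) * (x * b + (1ℚ - x) * d)
    swap = solve-∀ ℚ-ring

  expect-outcomes-split₂ : ∀ m (q : Fin m → ℚ) f i j → j ≢ i →
    let E = λ x y → expect (outcomes m (set (set q i x) j y)) f in
    expect (outcomes m q) f ≡
      q i * (q j * E 1ℚ 1ℚ + (1ℚ - q j) * E 1ℚ 0ℚ) + (1ℚ - q i) * (q j * E 0ℚ 1ℚ + (1ℚ - q j) * E 0ℚ 0ℚ)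
  expect-outcomes-split₂ m q f i j j≢i =
    trans (expect-outcomes-split m q f i) (cong₂ (λ a b → q i * a + (1ℚ - q i) * b) (splitAt-j 1ℚ) (splitAt-j 0ℚ))
    where
    splitAt-j : ∀ x → expect (outcomes m (set q i x)) f ≡
      q j * expect (outcomes m (set (set q i x) j 1ℚ)) f + (1ℚ - q j) * expect (outcomes m (set (set q i x) j 0ℚ)) f
    splitAt-j x rewrite sym (updateAt-minimal j i {const x} q j≢i) = expect-outcomes-split m (set q i x) f j

  set₂-indicator : ∀ {m} (q : Fin m → ℚ) (t : Fin m → Bool) i j x y →
    (∀ k → k ≢ i → k ≢ j → q k ≡ ind (t k)) → x ≡ ind (t i) → y ≡ ind (t j) →
    ∀ k → set (set q i x) j y k ≡ ind (t k)
  set₂-indicator q t i j x y elsewhere x≡ y≡ k with k FP.≟ j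
  ... | yes refl = trans (updateAt-updates k (set q i x)) y≡
  ... | no k≢j with k FP.≟ i
  ...   | yes refl = trans (updateAt-minimal k j (set q k x) k≢j) (trans (updateAt-updates k q) x≡)
  ...   | no k≢i =
    trans (updateAt-minimal k j (set q i x) k≢j) (trans (updateAt-minimal k i q k≢i) (elsewhere k k≢i k≢j))

  frac-self : ∀ d → frac (suc d) (suc d) ≡ 1ℚ
  frac-self d = fromℚᵘ-cong {mkℚᵘ (ℤ.+ suc d) d} {mkℚᵘ (ℤ.+ 1) 0} (*≡* (ℤP.*-comm (ℤ.+ suc d) (ℤ.+ 1)))

  b2n-split : ∀ x y → b2n x ≡ b2n (x ∧ y) ℕ.+ b2n (x ∧ not y)
  b2n-split false y = refl
  b2n-split true false = refl
  b2n-split true true = refl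

  ∧-false : ∀ {x y} → (x ≡ true → y ≡ false) → x ∧ y ≡ false
  ∧-false {false} _ = refl
  ∧-false {true} x⇒¬y = x⇒¬y refl

  map-allFin : ∀ {n} {A : Set} (g : Fin n → A) → L.map g (allFin n) ≡ L.tabulate g
  map-allFin g = LP.map-tabulate id g

  module _ {n} (adj : Adj n) (B : Coloring n) where

    missFactor : Fin n → Fin n → ℚ
    missFactor u w = if adj u w ∧ B u then 1ℚ - fireProb adj B u else 1ℚ

    blueProb-blue : ∀ w → B w ≡ true → blueProb adj B w ≡ 1ℚ
    blueProb-blue w Bw rewrite Bw = refl

    blueProb-white : ∀ w → B w ≡ false → blueProb adj B w ≡ 1ℚ - prodℚ (L.tabulate (λ u → missFactor u w))
    blueProb-white w Bw rewrite Bw = cong (λ l → 1ℚ - prodℚ l) (map-allFin (λ u → missFactor u w))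

    missFactor-silent : ∀ u w → adj u w ∧ B u ≡ false → missFactor u w ≡ 1ℚ
    missFactor-silent u w silent rewrite silent = refl

    missFactor-firing : ∀ u w → adj u w ≡ true → B u ≡ true → missFactor u w ≡ 1ℚ - fireProb adj B u
    missFactor-firing u w uw Bu rewrite uw | Bu = refl

    blueProb-noBlueNeighbour : ∀ w → B w ≡ false → (∀ u → adj u w ≡ true → B u ≡ false) →
      blueProb adj B w ≡ 0ℚ
    blueProb-noBlueNeighbour w Bw none = trans (blueProb-white w Bw)
      (cong (1ℚ -_) (fold-tabulate-ε *-1-commutativeMonoid _ (λ u → missFactor-silent u w (∧-false (none u)))))

    blueProb-sure : ∀ u w → B w ≡ false → adj u w ≡ true → B u ≡ true → fireProb adj B u ≡ 1ℚ →
      blueProb adj B w ≡ 1ℚ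
    blueProb-sure u w Bw uw Bu sure = trans (blueProb-white w Bw)
      (cong (1ℚ -_) (prodℚ-tabulate-zero _ u (trans (missFactor-firing u w uw Bu) (cong (1ℚ -_) sure))))

    blueProb-oneBlueNeighbour : ∀ u w → B w ≡ false → adj u w ≡ true → B u ≡ true →
      (∀ u′ → adj u′ w ≡ true → B u′ ≡ true → u′ ≡ u) → blueProb adj B w ≡ fireProb adj B u
    blueProb-oneBlueNeighbour u w Bw uw Bu only = begin
        blueProb adj B w
      ≡⟨ blueProb-white w Bw ⟩
        1ℚ - prodℚ (L.tabulate (λ u′ → missFactor u′ w))
      ≡⟨ cong (1ℚ -_) (fold-tabulate-single *-1-commutativeMonoid _ u others) ⟩
        1ℚ - missFactor u w
      ≡⟨ cong (1ℚ -_) (missFactor-firing u w uw Bu) ⟩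
        1ℚ - (1ℚ - fireProb adj B u)
      ≡⟨ cancel (fireProb adj B u) ⟩
        fireProb adj B u ∎
      where
      open ≡-Reasoning
      others : ∀ u′ → u′ ≢ u → missFactor u′ w ≡ 1ℚ
      others u′ u′≢u = missFactor-silent u′ w (∧-false notBlue)
        where
        notBlue : adj u′ w ≡ true → B u′ ≡ false
        notBlue u′w with B u′ in Bu′
        ... | true = ⊥-elim (u′≢u (only u′ u′w Bu′))
        ... | false = refl
      cancel : ∀ p → 1ℚ - (1ℚ - p) ≡ p
      cancel = solve-∀ ℚ-ring

    private
      blueNeighbours whiteNeighbours : Fin n → ℕ
      blueNeighbours u = sumℕ (L.tabulate (λ j → b2n (adj u j ∧ B j)))
      whiteNeighbours u = sumℕ (L.tabulate (λ j → b2n (adj u j ∧ not (B j))))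

      closedBlue≡ : ∀ u → B u ≡ true → closedBlue adj B u ≡ suc (blueNeighbours u)
      closedBlue≡ u Bu rewrite Bu = cong (λ l → suc (sumℕ l)) (map-allFin (λ j → b2n (adj u j ∧ B j)))

      deg≡ : ∀ u → deg adj u ≡ blueNeighbours u ℕ.+ whiteNeighbours u
      deg≡ u = begin
          deg adj u
        ≡⟨ cong sumℕ (map-allFin (λ j → b2n (adj u j))) ⟩
          sumℕ (L.tabulate (λ j → b2n (adj u j)))
        ≡⟨ cong sumℕ (LP.tabulate-cong (λ j → b2n-split (adj u j) (B j))) ⟩
          sumℕ (L.tabulate (λ j → b2n (adj u j ∧ B j) ℕ.+ b2n (adj u j ∧ not (B j))))
        ≡⟨ fold-tabulate-∙ ℕP.+-0-commutativeMonoid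
             (λ j → b2n (adj u j ∧ B j)) (λ j → b2n (adj u j ∧ not (B j))) ⟩
          blueNeighbours u ℕ.+ whiteNeighbours u ∎
        where open ≡-Reasoning

    fireProb-oneWhiteNeighbour : ∀ u w → B u ≡ true → adj u w ≡ true → B w ≡ false →
      (∀ j → adj u j ≡ true → B j ≡ false → j ≡ w) → fireProb adj B u ≡ 1ℚ
    fireProb-oneWhiteNeighbour u w Bu uw Bw only = begin
        frac (closedBlue adj B u) (deg adj u)
      ≡⟨ cong₂ frac (closedBlue≡ u Bu) (trans (deg≡ u) (cong (blueNeighbours u ℕ.+_) oneWhite)) ⟩
        frac (suc (blueNeighbours u)) (blueNeighbours u ℕ.+ 1)
      ≡⟨ cong (frac _) (ℕP.+-comm (blueNeighbours u) 1) ⟩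
        frac (suc (blueNeighbours u)) (suc (blueNeighbours u))
      ≡⟨ frac-self (blueNeighbours u) ⟩
        1ℚ ∎
      where
      open ≡-Reasoning
      oneWhite : whiteNeighbours u ≡ 1
      oneWhite = trans (fold-tabulate-single ℕP.+-0-commutativeMonoid _ w others)
                       (cong b2n (cong₂ _∧_ uw (cong not Bw)))
        where
        others : ∀ j → j ≢ w → b2n (adj u j ∧ not (B j)) ≡ 0
        others j j≢w = cong b2n (∧-false blue)
          where
          blue : adj u j ≡ true → not (B j) ≡ false
          blue uj with B j in Bj
          ... | true = refl
          ... | false = ⊥-elim (j≢w (only j uj Bj))

    fireProb-noBlueNeighbour : ∀ u → B u ≡ true → (∀ j → adj u j ≡ true → B j ≡ false) →
      fireProb adj B u ≡ frac 1 (deg adj u)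
    fireProb-noBlueNeighbour u Bu none =
      cong (λ c → frac c (deg adj u))
        (trans (closedBlue≡ u Bu)
               (cong suc (fold-tabulate-ε ℕP.+-0-commutativeMonoid _ (λ j → cong b2n (∧-false (none j))))))

module PathProcess where

  open import Data.Bool.Properties using (T-≡; T-∧; T-∨; ∨-zeroʳ; ∧-zeroʳ)
  open import Data.Integer using (+_)
  open import Data.Nat using (_≤_; _<_; _≤ᵇ_; _<ᵇ_; _≡ᵇ_; _∸_; _⊔_; _⊓_)
  open import Data.Rational using (ℚ; 0ℚ; 1ℚ; _+_; _*_; _-_; _/_)
  open import Data.Rational.Properties using (+-identityʳ)
  open import Function using (Equivalence)
  open import Tactic.RingSolver
  open Limits
  open Process

  open Equivalence using (to; from)

  ≡ᵇ-true : ∀ {m n} → m ≡ n → (m ≡ᵇ n) ≡ true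
  ≡ᵇ-true {m} {n} m≡n = to T-≡ (ℕP.≡⇒≡ᵇ m n m≡n)

  <ᵇ-true : ∀ {m n} → m < n → (m <ᵇ n) ≡ true
  <ᵇ-true m<n = to T-≡ (ℕP.<⇒<ᵇ m<n)

  ≤ᵇ-true : ∀ {m n} → m ≤ n → (m ≤ᵇ n) ≡ true
  ≤ᵇ-true m≤n = to T-≡ (ℕP.≤⇒≤ᵇ m≤n)

  pathAdj-down : ∀ {n} (u w : Fin n) → toℕ u ≡ suc (toℕ w) → pathAdj n u w ≡ true
  pathAdj-down u w e = cong (_∨ (toℕ w ≡ᵇ suc (toℕ u))) (≡ᵇ-true e)

  pathAdj-up : ∀ {n} (u w : Fin n) → toℕ w ≡ suc (toℕ u) → pathAdj n u w ≡ true
  pathAdj-up u w e = trans (cong ((toℕ u ≡ᵇ suc (toℕ w)) ∨_) (≡ᵇ-true e)) (∨-zeroʳ _)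

  pathAdj⁻ : ∀ {n} (u w : Fin n) → pathAdj n u w ≡ true → toℕ u ≡ suc (toℕ w) ⊎ toℕ w ≡ suc (toℕ u)
  pathAdj⁻ u w uw with to T-∨ (from T-≡ uw)
  ... | inj₁ down = inj₁ (ℕP.≡ᵇ⇒≡ _ _ down)
  ... | inj₂ up = inj₂ (ℕP.≡ᵇ⇒≡ _ _ up)

  inInterval : ℕ → ℕ → ℕ → Bool
  inInterval a b k = (a ≤ᵇ k) ∧ (k ≤ᵇ b)

  inInterval-true : ∀ {a b k} → a ≤ k → k ≤ b → inInterval a b k ≡ true
  inInterval-true a≤k k≤b = cong₂ _∧_ (≤ᵇ-true a≤k) (≤ᵇ-true k≤b)

  inInterval⁻ : ∀ {a b k} → inInterval a b k ≡ true → a ≤ k × k ≤ b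
  inInterval⁻ {a} {b} {k} e with to T-∧ (from T-≡ e)
  ... | a≤k , k≤b = ℕP.≤ᵇ⇒≤ a k a≤k , ℕP.≤ᵇ⇒≤ k b k≤b

  inInterval-outside : ∀ {a b k} → k < a ⊎ b < k → inInterval a b k ≡ false
  inInterval-outside {a} {b} {k} out with inInterval a b k in e
  ... | false = refl
  ... | true with inInterval⁻ e | out
  ...   | a≤k , _ | inj₁ k<a = ⊥-elim (ℕP.<⇒≱ k<a a≤k)
  ...   | _ , k≤b | inj₂ b<k = ⊥-elim (ℕP.<⇒≱ b<k k≤b)

  inInterval-false⁻ : ∀ {a b k} → inInterval a b k ≡ false → k < a ⊎ b < k
  inInterval-false⁻ {a} {b} {k} e with a ℕP.≤? k | k ℕP.≤? b
  ... | yes a≤k | yes k≤b with () ← trans (sym e) (inInterval-true a≤k k≤b)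
  ... | no a≰k | _ = inj₁ (ℕP.≰⇒> a≰k)
  ... | _ | no k≰b = inj₂ (ℕP.≰⇒> k≰b)

  allBlue-true : ∀ {m} (v : Vec Bool m) → (∀ i → lookup v i ≡ true) → allBlue v ≡ true
  allBlue-true [] _ = refl
  allBlue-true (x ∷ v) all rewrite all F.zero = allBlue-true v (all ∘ F.suc)

  allBlue-false : ∀ {m} (v : Vec Bool m) i → lookup v i ≡ false → allBlue v ≡ false
  allBlue-false (x ∷ v) F.zero white rewrite white = refl
  allBlue-false (x ∷ v) (F.suc i) white rewrite allBlue-false v i white = ∧-zeroʳ x

  fromℕ-suc-⊓ : ∀ m r → fromℕ (suc m ⊓ r) ≡ fromℕ (m ⊓ r) + ind (m <ᵇ r)
  fromℕ-suc-⊓ zero zero = sym (+-identityʳ _)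
  fromℕ-suc-⊓ (suc m) zero = sym (+-identityʳ _)
  fromℕ-suc-⊓ zero (suc r) = fromℕ-suc 0
  fromℕ-suc-⊓ (suc m) (suc r) = begin
      fromℕ (suc (suc m ⊓ r))                  ≡⟨ fromℕ-suc (suc m ⊓ r) ⟩
      fromℕ (suc m ⊓ r) + 1ℚ                   ≡⟨ cong (_+ 1ℚ) (fromℕ-suc-⊓ m r) ⟩
      fromℕ (m ⊓ r) + ind (m <ᵇ r) + 1ℚ        ≡⟨ shuffle (fromℕ (m ⊓ r)) (ind (m <ᵇ r)) ⟩
      fromℕ (m ⊓ r) + 1ℚ + ind (m <ᵇ r)        ≡⟨ cong (_+ ind (m <ᵇ r)) (sym (fromℕ-suc (m ⊓ r))) ⟩
      fromℕ (suc (m ⊓ r)) + ind (m <ᵇ r)       ∎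
    where
    open ≡-Reasoning
    shuffle : ∀ x y → x + y + 1ℚ ≡ x + 1ℚ + y
    shuffle = solve-∀ ℚ-ring

  <ᵇ-pred : ∀ k r → (k <ᵇ r ∸ 1) ≡ (suc k <ᵇ r)
  <ᵇ-pred k zero = refl
  <ᵇ-pred k (suc r) = refl

  module Path (n : ℕ) where

    adj : Adj n
    adj = pathAdj n

    interval : ℕ → ℕ → Vec Bool n
    interval a b = V.tabulate (λ i → inInterval a b (toℕ i))

    lookup-interval : ∀ a b i → lookup (interval a b) i ≡ inInterval a b (toℕ i)
    lookup-interval a b = VP.lookup∘tabulate (λ i → inInterval a b (toℕ i))

    blueProb-far : ∀ a b w → suc (toℕ w) < a ⊎ suc b < toℕ w → blueProb adj (lookup (interval a b)) w ≡ 0ℚ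
    blueProb-far a b w far =
      blueProb-noBlueNeighbour adj (lookup (interval a b)) w
        (trans (lookup-interval a b w) (inInterval-outside (wOutside far)))
        (λ u uw → trans (lookup-interval a b u) (inInterval-outside (neighbourOutside u (pathAdj⁻ u w uw) far)))
      where
      wOutside : suc (toℕ w) < a ⊎ suc b < toℕ w → toℕ w < a ⊎ b < toℕ w
      wOutside (inj₁ w+1<a) = inj₁ (ℕP.<-trans (ℕP.n<1+n _) w+1<a)
      wOutside (inj₂ b+1<w) = inj₂ (ℕP.<-trans (ℕP.n<1+n b) b+1<w)
      neighbourOutside : ∀ u → toℕ u ≡ suc (toℕ w) ⊎ toℕ w ≡ suc (toℕ u) →
        suc (toℕ w) < a ⊎ suc b < toℕ w → toℕ u < a ⊎ b < toℕ u
      neighbourOutside u (inj₁ e) (inj₁ w+1<a) = inj₁ (subst (_< a) (sym e) w+1<a)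
      neighbourOutside u (inj₁ e) (inj₂ b+1<w) =
        inj₂ (subst (b <_) (sym e) (ℕP.<-trans (ℕP.n<1+n b) (ℕP.m<n⇒m<1+n b+1<w)))
      neighbourOutside u (inj₂ e) (inj₁ w+1<a) =
        inj₁ (ℕP.<-trans (ℕP.n<1+n _) (ℕP.<-trans (ℕP.n<1+n _) (subst (λ k → suc k < a) e w+1<a)))
      neighbourOutside u (inj₂ e) (inj₂ b+1<w) = inj₂ (ℕ.s<s⁻¹ (subst (suc b <_) e b+1<w))

    -- Each endpoint of the blue interval [a, b] has at most one white neighbour, so it fires with
    -- probability 1 and the interval grows by one vertex on each side in every round.
    record SureGrowth (a b : ℕ) : Set where
      field
        a≤b : a ≤ b
        a<n : a < n
        shape : a < b ⊎ a ≡ 0 ⊎ n ≤ suc b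

    blueProb-leftFrontier : ∀ {a b} → SureGrowth a b → ∀ w → suc (toℕ w) ≡ a →
      blueProb adj (lookup (interval a b)) w ≡ 1ℚ
    blueProb-leftFrontier {a} {b} growth w w+1≡a =
      blueProb-sure adj B u w Bw uw Bu (fireProb-oneWhiteNeighbour adj B u w Bu uw Bw only)
      where
      open SureGrowth growth
      B = lookup (interval a b)
      u = F.fromℕ< a<n
      u≡a : toℕ u ≡ a
      u≡a = FP.toℕ-fromℕ< a<n
      uw : adj u w ≡ true
      uw = pathAdj-down u w (trans u≡a (sym w+1≡a))
      Bu : B u ≡ true
      Bu = trans (lookup-interval a b u) (inInterval-true (ℕP.≤-reflexive (sym u≡a)) (subst (_≤ b) (sym u≡a) a≤b))
      Bw : B w ≡ false
      Bw = trans (lookup-interval a b w) (inInterval-outside (inj₁ (subst (toℕ w <_) w+1≡a (ℕP.n<1+n _))))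
      only : ∀ j → adj u j ≡ true → B j ≡ false → j ≡ w
      only j uj Bj with pathAdj⁻ u j uj | inInterval-false⁻ (trans (sym (lookup-interval a b j)) Bj)
      ... | inj₁ e | _ = FP.toℕ-injective (ℕP.suc-injective (trans (sym e) (trans u≡a (sym w+1≡a))))
      ... | inj₂ e | inj₁ j<a = ⊥-elim (ℕP.<-asym j<a (subst (a <_) (sym (trans e (cong suc u≡a))) (ℕP.n<1+n a)))
      ... | inj₂ e | inj₂ b<j with shape
      ...   | inj₁ a<b = ⊥-elim (ℕP.<⇒≱ a<b (ℕ.s≤s⁻¹ (subst (b <_) (trans e (cong suc u≡a)) b<j)))
      ...   | inj₂ (inj₁ a≡0) = ⊥-elim (ℕP.1+n≢0 (trans w+1≡a a≡0))
      ...   | inj₂ (inj₂ n≤b+1) = ⊥-elim (ℕP.<⇒≱ (FP.toℕ<n j) (ℕP.≤-trans n≤b+1 b<j))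

    blueProb-rightFrontier : ∀ {a b} → SureGrowth a b → ∀ w → toℕ w ≡ suc b →
      blueProb adj (lookup (interval a b)) w ≡ 1ℚ
    blueProb-rightFrontier {a} {b} growth w w≡b+1 =
      blueProb-sure adj B u w Bw uw Bu (fireProb-oneWhiteNeighbour adj B u w Bu uw Bw only)
      where
      open SureGrowth growth
      B = lookup (interval a b)
      b+1<n : suc b < n
      b+1<n = subst (_< n) w≡b+1 (FP.toℕ<n w)
      u = F.fromℕ< (ℕP.<-trans (ℕP.n<1+n b) b+1<n)
      u≡b : toℕ u ≡ b
      u≡b = FP.toℕ-fromℕ< _
      uw : adj u w ≡ true
      uw = pathAdj-up u w (trans w≡b+1 (cong suc (sym u≡b)))
      Bu : B u ≡ true
      Bu = trans (lookup-interval a b u) (inInterval-true (subst (a ≤_) (sym u≡b) a≤b) (ℕP.≤-reflexive u≡b))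
      Bw : B w ≡ false
      Bw = trans (lookup-interval a b w) (inInterval-outside {a} (inj₂ (subst (b <_) (sym w≡b+1) (ℕP.n<1+n b))))
      only : ∀ j → adj u j ≡ true → B j ≡ false → j ≡ w
      only j uj Bj with pathAdj⁻ u j uj | inInterval-false⁻ (trans (sym (lookup-interval a b j)) Bj)
      ... | inj₂ e | _ = FP.toℕ-injective (trans e (trans (cong suc u≡b) (sym w≡b+1)))
      ... | inj₁ e | inj₂ b<j = ⊥-elim (ℕP.<-asym b<j (ℕP.≤-reflexive (trans (sym e) u≡b)))
      ... | inj₁ e | inj₁ j<a with shape
      ...   | inj₁ a<b = ⊥-elim (ℕP.<⇒≱ a<b (subst (_≤ a) (trans (sym e) u≡b) j<a))
      ...   | inj₂ (inj₁ a≡0) = ⊥-elim (ℕP.n≮0 (subst (toℕ j <_) a≡0 j<a))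
      ...   | inj₂ (inj₂ n≤b+1) = ⊥-elim (ℕP.<⇒≱ b+1<n n≤b+1)

    blueProb-sureGrowth : ∀ {a b} → SureGrowth a b → ∀ w →
      blueProb adj (lookup (interval a b)) w ≡ ind (inInterval (a ∸ 1) (suc b) (toℕ w))
    blueProb-sureGrowth {a} {b} growth w with toℕ w ℕP.<? a
    ... | yes w<a with suc (toℕ w) ℕP.≟ a
    ...   | yes w+1≡a = trans (blueProb-leftFrontier growth w w+1≡a) (cong ind (sym (inInterval-true
              (ℕP.≤-reflexive (cong (_∸ 1) (sym w+1≡a))) (ℕP.≤-trans (ℕP.<⇒≤ w<a) (ℕP.m≤n⇒m≤1+n a≤b)))))
      where open SureGrowth growth
    ...   | no w+1≢a =
      trans (blueProb-far a b w (inj₁ w+1<a)) (cong ind (sym (inInterval-outside (inj₁ (ℕP.<⇒≤pred w+1<a)))))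
      where
      w+1<a : suc (toℕ w) < a
      w+1<a = ℕP.≤∧≢⇒< w<a w+1≢a
    blueProb-sureGrowth {a} {b} growth w | no w≮a with toℕ w ℕP.≤? b
    ... | yes w≤b =
      trans (blueProb-blue adj (lookup (interval a b)) w (trans (lookup-interval a b w) (inInterval-true a≤w w≤b)))
            (cong ind (sym (inInterval-true (ℕP.≤-trans (ℕP.m∸n≤m a 1) a≤w) (ℕP.m≤n⇒m≤1+n w≤b))))
      where
      a≤w : a ≤ toℕ w
      a≤w = ℕP.≮⇒≥ w≮a
    ... | no w≰b with toℕ w ℕP.≟ suc b
    ...   | yes w≡b+1 = trans (blueProb-rightFrontier growth w w≡b+1) (cong ind (sym (inInterval-true
              (ℕP.≤-trans (ℕP.m∸n≤m a 1) (ℕP.≮⇒≥ w≮a)) (ℕP.≤-reflexive w≡b+1))))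
    ...   | no w≢b+1 = trans (blueProb-far a b w (inj₂ b+1<w)) (cong ind (sym (inInterval-outside {a ∸ 1} (inj₂ b+1<w))))
      where
      b+1<w : suc b < toℕ w
      b+1<w = ℕP.≤∧≢⇒< (ℕP.≰⇒> w≰b) (w≢b+1 ∘ sym)

    roundExpect-sureGrowth : ∀ {a b} → SureGrowth a b → ∀ f →
      roundExpect adj f (interval a b) ≡ f (interval (a ∸ 1) (suc b))
    roundExpect-sureGrowth {a} {b} growth f =
      expect-outcomes-indicator n _ f (interval (a ∸ 1) (suc b))
        (λ i → trans (blueProb-sureGrowth growth i) (cong ind (sym (lookup-interval (a ∸ 1) (suc b) i))))

    sureGrowth-step : ∀ {a b} → SureGrowth a b → SureGrowth (a ∸ 1) (suc b)
    sureGrowth-step {a} growth = record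
      { a≤b = ℕP.≤-trans (ℕP.m∸n≤m a 1) (ℕP.m≤n⇒m≤1+n a≤b)
      ; a<n = ℕP.≤-<-trans (ℕP.m∸n≤m a 1) a<n
      ; shape = inj₁ (s≤s (ℕP.≤-trans (ℕP.m∸n≤m a 1) a≤b))
      }
      where open SureGrowth growth

    roundsLeft : ℕ → ℕ → ℕ
    roundsLeft a b = a ⊔ (n ∸ suc b)

    roundsLeft-step : ∀ a b → roundsLeft (a ∸ 1) (suc b) ≡ roundsLeft a b ∸ 1
    roundsLeft-step a b =
      trans (cong ((a ∸ 1) ⊔_) (sym (ℕP.pred[m∸n]≡m∸[1+n] n (suc b)))) (sym (ℕP.∸-distribʳ-⊔ 1 a (n ∸ suc b)))

    someWhite-white : ∀ a b k (k<n : k < n) → inInterval a b k ≡ false → someWhite (interval a b) ≡ 1ℚ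
    someWhite-white a b k k<n white =
      cong (λ c → if c then 0ℚ else 1ℚ) (allBlue-false (interval a b) (F.fromℕ< k<n)
        (trans (lookup-interval a b _) (trans (cong (inInterval a b) (FP.toℕ-fromℕ< k<n)) white)))

    someWhite-interval : ∀ a b → a < n → someWhite (interval a b) ≡ ind (0 <ᵇ roundsLeft a b)
    someWhite-interval (suc a) b a+1<n =
      trans (someWhite-white (suc a) b a (ℕP.<-trans (ℕP.n<1+n a) a+1<n) (inInterval-outside (inj₁ (ℕP.n<1+n a))))
            (cong ind (sym (<ᵇ-true (ℕP.<-≤-trans ℕ.z<s (ℕP.m≤m⊔n (suc a) (n ∸ suc b))))))
    someWhite-interval zero b _ with n ℕP.≤? suc b
    ... | yes n≤b+1 =
      trans (cong (λ c → if c then 0ℚ else 1ℚ) (allBlue-true (interval zero b) allIn))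
            (cong (λ t → ind (0 <ᵇ t)) (sym (ℕP.m≤n⇒m∸n≡0 n≤b+1)))
      where
      allIn : ∀ i → lookup (interval zero b) i ≡ true
      allIn i = trans (lookup-interval zero b i) (inInterval-true z≤n (ℕ.s≤s⁻¹ (ℕP.<-≤-trans (FP.toℕ<n i) n≤b+1)))
    ... | no n≰b+1 =
      trans (someWhite-white zero b (suc b) b+1<n (inInterval-outside {0} (inj₂ (ℕP.n<1+n b))))
            (cong ind (sym (<ᵇ-true (ℕP.m<n⇒0<n∸m b+1<n))))
      where
      b+1<n : suc b < n
      b+1<n = ℕP.≰⇒> n≰b+1

    afterRounds-sureGrowth : ∀ k {a b} → SureGrowth a b →
      afterRounds adj k someWhite (interval a b) ≡ ind (k <ᵇ roundsLeft a b)
    afterRounds-sureGrowth zero {a} {b} growth = someWhite-interval a b (SureGrowth.a<n growth)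
    afterRounds-sureGrowth (suc k) {a} {b} growth = begin
        roundExpect adj (afterRounds adj k someWhite) (interval a b)
      ≡⟨ roundExpect-sureGrowth growth _ ⟩
        afterRounds adj k someWhite (interval (a ∸ 1) (suc b))
      ≡⟨ afterRounds-sureGrowth k (sureGrowth-step growth) ⟩
        ind (k <ᵇ roundsLeft (a ∸ 1) (suc b))
      ≡⟨ cong ind (trans (cong (k <ᵇ_) (roundsLeft-step a b)) (<ᵇ-pred k (roundsLeft a b))) ⟩
        ind (suc k <ᵇ roundsLeft a b) ∎
      where open ≡-Reasoning

    partialEpt-sureGrowth : ∀ {a b} → SureGrowth a b → ∀ m →
      partialEpt adj (interval a b) m ≡ fromℕ (m ⊓ roundsLeft a b)
    partialEpt-sureGrowth growth zero = refl
    partialEpt-sureGrowth {a} {b} growth (suc m) =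
      trans (cong₂ _+_ (partialEpt-sureGrowth growth m)
                       (trans (probNotDone≡afterRounds adj (interval a b) m) (afterRounds-sureGrowth m growth)))
            (sym (fromℕ-suc-⊓ m (roundsLeft a b)))

    ept-sureGrowth : ∀ {a b} → SureGrowth a b → EptFrom≡ adj (interval a b) (fromℕ (roundsLeft a b))
    ept-sureGrowth {a} {b} growth = converges-eventuallyConstant _ (roundsLeft a b) _
      (λ m r≤m → trans (partialEpt-sureGrowth growth m) (cong fromℕ (ℕP.m≥n⇒m⊓n≡n r≤m)))

    sureGrowth-proper : ∀ {a b} → a < b → a < n → SureGrowth a b
    sureGrowth-proper a<b a<n = record { a≤b = ℕP.<⇒≤ a<b ; a<n = a<n ; shape = inj₁ a<b }

    -- The blue vertex is suc v, so that its neighbours v and suc (suc v) need no subtraction.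
    module Centre (v : ℕ) (v+2<n : suc (suc v) < n) where

      left centre right : Fin n
      left = F.fromℕ< (ℕP.<-trans (ℕP.n<1+n v) (ℕP.<-trans (ℕP.n<1+n (suc v)) v+2<n))
      centre = F.fromℕ< (ℕP.<-trans (ℕP.n<1+n (suc v)) v+2<n)
      right = F.fromℕ< v+2<n

      left≡ : toℕ left ≡ v
      left≡ = FP.toℕ-fromℕ< _
      centre≡ : toℕ centre ≡ suc v
      centre≡ = FP.toℕ-fromℕ< _
      right≡ : toℕ right ≡ suc (suc v)
      right≡ = FP.toℕ-fromℕ< _

      B : Coloring n
      B = lookup (interval (suc v) (suc v))

      B≡true⁻ : ∀ u → B u ≡ true → u ≡ centre
      B≡true⁻ u Bu with inInterval⁻ (trans (sym (lookup-interval (suc v) (suc v) u)) Bu)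
      ... | v+1≤u , u≤v+1 = FP.toℕ-injective (trans (ℕP.≤-antisym u≤v+1 v+1≤u) (sym centre≡))

      B-false : ∀ u → toℕ u ≢ suc v → B u ≡ false
      B-false u u≢v+1 with B u in Bu
      ... | true = ⊥-elim (u≢v+1 (trans (cong toℕ (B≡true⁻ u Bu)) centre≡))
      ... | false = refl

      B-centre : B centre ≡ true
      B-centre = trans (lookup-interval (suc v) (suc v) centre)
                       (inInterval-true (ℕP.≤-reflexive (sym centre≡)) (ℕP.≤-reflexive centre≡))

      left≢right : left ≢ right
      left≢right e = ℕP.<⇒≢ (ℕP.m<n⇒m<1+n (ℕP.n<1+n v)) (trans (sym left≡) (trans (cong toℕ e) right≡))

      neighbour⁻ : ∀ j → adj centre j ≡ true → j ≡ left ⊎ j ≡ right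
      neighbour⁻ j cj with pathAdj⁻ centre j cj
      ... | inj₁ e = inj₁ (FP.toℕ-injective (trans (ℕP.suc-injective (trans (sym e) centre≡)) (sym left≡)))
      ... | inj₂ e = inj₂ (FP.toℕ-injective (trans e (trans (cong suc centre≡) (sym right≡))))

      adj-left : adj centre left ≡ true
      adj-left = pathAdj-down centre left (trans centre≡ (cong suc (sym left≡)))

      adj-right : adj centre right ≡ true
      adj-right = pathAdj-up centre right (trans right≡ (cong suc (sym centre≡)))

      deg-centre : deg adj centre ≡ 2
      deg-centre = begin
          deg adj centre
        ≡⟨ cong sumℕ (map-allFin (b2n ∘ adj centre)) ⟩
          sumℕ (L.tabulate (b2n ∘ adj centre))
        ≡⟨ fold-tabulate-pair ℕP.+-0-commutativeMonoid (b2n ∘ adj centre) left right left≢right others ⟩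
          b2n (adj centre left) ℕ.+ b2n (adj centre right)
        ≡⟨ cong₂ ℕ._+_ (cong b2n adj-left) (cong b2n adj-right) ⟩
          2 ∎
        where
        open ≡-Reasoning
        others : ∀ k → k ≢ left → k ≢ right → b2n (adj centre k) ≡ 0
        others k k≢l k≢r with adj centre k in ck
        ... | false = refl
        ... | true with neighbour⁻ k ck
        ...   | inj₁ k≡l = ⊥-elim (k≢l k≡l)
        ...   | inj₂ k≡r = ⊥-elim (k≢r k≡r)

      beside≢centre : ∀ w → w ≡ left ⊎ w ≡ right → toℕ w ≢ suc v
      beside≢centre _ (inj₁ refl) = ℕP.<⇒≢ (ℕP.n<1+n v) ∘ trans (sym left≡)
      beside≢centre _ (inj₂ refl) = ℕP.<⇒≢ (ℕP.n<1+n (suc v)) ∘ sym ∘ trans (sym right≡)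

      adj-beside : ∀ w → w ≡ left ⊎ w ≡ right → adj centre w ≡ true
      adj-beside _ (inj₁ refl) = adj-left
      adj-beside _ (inj₂ refl) = adj-right

      fireProb-centre : fireProb adj B centre ≡ ½
      fireProb-centre = trans (fireProb-noBlueNeighbour adj B centre B-centre noBlue) (cong (frac 1) deg-centre)
        where
        noBlue : ∀ j → adj centre j ≡ true → B j ≡ false
        noBlue j cj = B-false j (beside≢centre j (neighbour⁻ j cj))

      blueProb-beside : ∀ w → w ≡ left ⊎ w ≡ right → blueProb adj B w ≡ ½
      blueProb-beside w beside =
        trans (blueProb-oneBlueNeighbour adj B centre w (B-false w (beside≢centre w beside)) (adj-beside w beside) B-centre
                (λ u _ Bu → B≡true⁻ u Bu))
              fireProb-centre

      blueProb-elsewhere : ∀ a′ b′ → v ≤ a′ → a′ ≤ suc v → suc v ≤ b′ → b′ ≤ suc (suc v) →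
        ∀ w → w ≢ left → w ≢ right → blueProb adj B w ≡ ind (inInterval a′ b′ (toℕ w))
      blueProb-elsewhere a′ b′ v≤a′ a′≤v+1 v+1≤b′ b′≤v+2 w w≢l w≢r with ℕP.<-cmp (toℕ w) (suc v)
      ... | tri≈ _ w≡v+1 _ =
        trans (blueProb-blue adj B w (trans (lookup-interval (suc v) (suc v) w)
                                            (inInterval-true (ℕP.≤-reflexive (sym w≡v+1)) (ℕP.≤-reflexive w≡v+1))))
              (cong ind (sym (inInterval-true (subst (a′ ≤_) (sym w≡v+1) a′≤v+1)
                                              (subst (_≤ b′) (sym w≡v+1) v+1≤b′))))
      ... | tri< w<v+1 _ _ =
        trans (blueProb-far (suc v) (suc v) w (inj₁ (s≤s w<v)))
              (cong ind (sym (inInterval-outside (inj₁ (ℕP.<-≤-trans w<v v≤a′)))))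
        where
        w<v : toℕ w < v
        w<v = ℕP.≤∧≢⇒< (ℕ.s≤s⁻¹ w<v+1) (λ e → w≢l (FP.toℕ-injective (trans e (sym left≡))))
      ... | tri> _ _ v+1<w =
        trans (blueProb-far (suc v) (suc v) w (inj₂ v+2<w))
              (cong ind (sym (inInterval-outside {a′} (inj₂ (ℕP.≤-<-trans b′≤v+2 v+2<w)))))
        where
        v+2<w : suc (suc v) < toℕ w
        v+2<w = ℕP.≤∧≢⇒< v+1<w (λ e → w≢r (FP.toℕ-injective (trans (sym e) (sym right≡))))

      lo hi : Bool → ℕ
      lo x = if x then v else suc v
      hi y = if y then suc (suc v) else suc v

      lo-bounds : ∀ x → v ≤ lo x × lo x ≤ suc v
      lo-bounds true = ℕP.≤-refl , ℕP.n≤1+n v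
      lo-bounds false = ℕP.n≤1+n v , ℕP.≤-refl

      hi-bounds : ∀ y → suc v ≤ hi y × hi y ≤ suc (suc v)
      hi-bounds true = ℕP.n≤1+n (suc v) , ℕP.≤-refl
      hi-bounds false = ℕP.≤-refl , ℕP.n≤1+n (suc v)

      ind-left : ∀ x y → ind x ≡ ind (inInterval (lo x) (hi y) (toℕ left))
      ind-left true y = cong ind (sym (inInterval-true (ℕP.≤-reflexive (sym left≡))
                                    (subst (_≤ hi y) (sym left≡) (ℕP.≤-trans (ℕP.n≤1+n v) (proj₁ (hi-bounds y))))))
      ind-left false y = cong ind (sym (inInterval-outside (inj₁ (subst (_< suc v) (sym left≡) (ℕP.n<1+n v)))))

      ind-right : ∀ x y → ind y ≡ ind (inInterval (lo x) (hi y) (toℕ right))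
      ind-right x true = cong ind (sym (inInterval-true
                                     (subst (lo x ≤_) (sym right≡) (ℕP.≤-trans (proj₂ (lo-bounds x)) (ℕP.n≤1+n (suc v))))
                                     (ℕP.≤-reflexive right≡)))
      ind-right x false = cong ind (sym (inInterval-outside {lo x} (inj₂ (subst (suc v <_) (sym right≡) (ℕP.n<1+n (suc v))))))

      I : Bool → Bool → Vec Bool n
      I x y = interval (lo x) (hi y)

      roundExpect-branch : ∀ f x y →
        expect (outcomes n (set (set (blueProb adj B) left (ind x)) right (ind y))) f ≡ f (I x y)
      roundExpect-branch f x y =
        expect-outcomes-indicator n _ f (interval (lo x) (hi y))
          (λ k → trans (set₂-indicator (blueProb adj B) (λ k → inInterval (lo x) (hi y) (toℕ k)) left right (ind x) (ind y)
                          elsewhere (ind-left x y) (ind-right x y) k)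
                       (cong ind (sym (lookup-interval (lo x) (hi y) k))))
        where
        elsewhere : ∀ k → k ≢ left → k ≢ right → blueProb adj B k ≡ ind (inInterval (lo x) (hi y) (toℕ k))
        elsewhere = blueProb-elsewhere (lo x) (hi y) (proj₁ (lo-bounds x)) (proj₂ (lo-bounds x))
                                       (proj₁ (hi-bounds y)) (proj₂ (hi-bounds y))

      roundExpect-centre : ∀ f →
        roundExpect adj f (interval (suc v) (suc v))
          ≡ ¼ * (f (I true true) + f (I true false) + f (I false true) + f (I false false))
      roundExpect-centre f = begin
          expect (outcomes n q) f
        ≡⟨ expect-outcomes-split₂ n q f left right (left≢right ∘ sym) ⟩
          q left * (q right * E true true + (1ℚ - q right) * E true false)
            + (1ℚ - q left) * (q right * E false true + (1ℚ - q right) * E false false)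
        ≡⟨ cong₂ (λ a b → a * (b * E true true + (1ℚ - b) * E true false)
                          + (1ℚ - a) * (b * E false true + (1ℚ - b) * E false false))
                 (blueProb-beside left (inj₁ refl)) (blueProb-beside right (inj₂ refl)) ⟩
          ½ * (½ * E true true + ½ * E true false) + ½ * (½ * E false true + ½ * E false false)
        ≡⟨ average (E true true) (E true false) (E false true) (E false false) ⟩
          ¼ * (E true true + E true false + E false true + E false false)
        ≡⟨ cong (¼ *_) (cong₂ _+_ (cong₂ _+_ (cong₂ _+_ (roundExpect-branch f true true) (roundExpect-branch f true false))
                                             (roundExpect-branch f false true))
                                  (roundExpect-branch f false false)) ⟩
          ¼ * (f (I true true) + f (I true false) + f (I false true) + f (I false false)) ∎
        where
        open ≡-Reasoning
        q = blueProb adj B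
        E : Bool → Bool → ℚ
        E x y = expect (outcomes n (set (set q left (ind x)) right (ind y))) f
        average : ∀ a b c d → ½ * (½ * a + ½ * b) + ½ * (½ * c + ½ * d) ≡ ¼ * (a + b + c + d)
        average = solve-∀ ℚ-ring

      V : Vec Bool n
      V = interval (suc v) (suc v)

      r₁₁ r₁₀ r₀₁ : ℕ
      r₁₁ = roundsLeft v (suc (suc v))
      r₁₀ = roundsLeft v (suc v)
      r₀₁ = roundsLeft (suc v) (suc (suc v))

      v<n : v < n
      v<n = ℕP.<-trans (ℕP.n<1+n v) (ℕP.<-trans (ℕP.n<1+n (suc v)) v+2<n)

      afterRounds₁₁ : ∀ k → afterRounds adj k someWhite (interval v (suc (suc v))) ≡ ind (k <ᵇ r₁₁)
      afterRounds₁₁ k = afterRounds-sureGrowth k (sureGrowth-proper (ℕP.m<n⇒m<1+n (ℕP.n<1+n v)) v<n)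
      afterRounds₁₀ : ∀ k → afterRounds adj k someWhite (interval v (suc v)) ≡ ind (k <ᵇ r₁₀)
      afterRounds₁₀ k = afterRounds-sureGrowth k (sureGrowth-proper (ℕP.n<1+n v) v<n)
      afterRounds₀₁ : ∀ k → afterRounds adj k someWhite (interval (suc v) (suc (suc v))) ≡ ind (k <ᵇ r₀₁)
      afterRounds₀₁ k =
        afterRounds-sureGrowth k (sureGrowth-proper (ℕP.n<1+n (suc v)) (ℕP.<-trans (ℕP.n<1+n (suc v)) v+2<n))

      s : ℕ → ℚ
      s = partialEpt adj V

      p : ℕ → ℚ
      p = probNotDone adj V

      branchSum : ℕ → ℚ
      branchSum m = fromℕ (m ⊓ r₁₁) + fromℕ (m ⊓ r₁₀) + fromℕ (m ⊓ r₀₁)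

      partialEpt-centre-suc : ∀ m → s (suc m) ≡ 1ℚ + ¼ * s m + ¼ * branchSum m
      partialEpt-centre-suc zero =
        cong (λ z → 0ℚ + z) (trans (probNotDone≡afterRounds adj V 0)
                     (trans (someWhite-interval (suc v) (suc v) (ℕP.<-trans (ℕP.n<1+n (suc v)) v+2<n))
                            (cong ind (<ᵇ-true (ℕP.<-≤-trans ℕ.z<s (ℕP.m≤m⊔n (suc v) (n ∸ suc (suc v))))))))
      partialEpt-centre-suc (suc m) = begin
          s (suc m) + p (suc m)
        ≡⟨ cong₂ _+_ (partialEpt-centre-suc m) (trans (probNotDone≡afterRounds adj V (suc m)) (roundExpect-centre _)) ⟩
          (1ℚ + ¼ * s m + ¼ * branchSum m)
            + ¼ * (A (I true true) + A (I true false) + A (I false true) + A V)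
        ≡⟨ cong (λ z → (1ℚ + ¼ * s m + ¼ * branchSum m) + ¼ * z)
                (cong₂ _+_ (cong₂ _+_ (cong₂ _+_ (afterRounds₁₁ m) (afterRounds₁₀ m)) (afterRounds₀₁ m))
                           (sym (probNotDone≡afterRounds adj V m))) ⟩
          (1ℚ + ¼ * s m + ¼ * branchSum m) + ¼ * (ind (m <ᵇ r₁₁) + ind (m <ᵇ r₁₀) + ind (m <ᵇ r₀₁) + p m)
        ≡⟨ regroup (s m) (fromℕ (m ⊓ r₁₁)) (fromℕ (m ⊓ r₁₀)) (fromℕ (m ⊓ r₀₁))
                   (ind (m <ᵇ r₁₁)) (ind (m <ᵇ r₁₀)) (ind (m <ᵇ r₀₁)) (p m) ⟩
          1ℚ + ¼ * (s m + p m)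
            + ¼ * ((fromℕ (m ⊓ r₁₁) + ind (m <ᵇ r₁₁)) + (fromℕ (m ⊓ r₁₀) + ind (m <ᵇ r₁₀))
                   + (fromℕ (m ⊓ r₀₁) + ind (m <ᵇ r₀₁)))
        ≡⟨ cong (λ z → 1ℚ + ¼ * s (suc m) + ¼ * z)
                (sym (cong₂ _+_ (cong₂ _+_ (fromℕ-suc-⊓ m r₁₁) (fromℕ-suc-⊓ m r₁₀)) (fromℕ-suc-⊓ m r₀₁))) ⟩
          1ℚ + ¼ * s (suc m) + ¼ * branchSum (suc m) ∎
        where
        open ≡-Reasoning
        A = afterRounds adj m someWhite
        regroup : ∀ S x y z a b c d →
          (1ℚ + ¼ * S + ¼ * (x + y + z)) + ¼ * (a + b + c + d) ≡ 1ℚ + ¼ * (S + d) + ¼ * ((x + a) + (y + b) + (z + c))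
        regroup = solve-∀ ℚ-ring

      c : ℕ
      c = r₁₁ ℕ.+ r₁₀ ℕ.+ r₀₁

      ept-centre : EptFrom≡ adj V ((+ (8 ℕ.+ 2 ℕ.* c)) / 6)
      ept-centre = converges-contraction s (r₁₁ ⊔ r₁₀ ⊔ r₀₁) {1ℚ + ¼ * fromℕ c} recurrence fixed
        where
        branchSum-stable : ∀ m → r₁₁ ⊔ r₁₀ ⊔ r₀₁ ≤ m → branchSum m ≡ fromℕ c
        branchSum-stable m R≤m = begin
            fromℕ (m ⊓ r₁₁) + fromℕ (m ⊓ r₁₀) + fromℕ (m ⊓ r₀₁)
          ≡⟨ cong₂ _+_ (cong₂ _+_ (settled (ℕP.≤-trans (ℕP.m≤m⊔n r₁₁ r₁₀) (ℕP.m≤m⊔n _ r₀₁)))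
                                  (settled (ℕP.≤-trans (ℕP.m≤n⊔m r₁₁ r₁₀) (ℕP.m≤m⊔n _ r₀₁))))
                       (settled (ℕP.m≤n⊔m (r₁₁ ⊔ r₁₀) r₀₁)) ⟩
            fromℕ r₁₁ + fromℕ r₁₀ + fromℕ r₀₁
          ≡⟨ sym (trans (fromℕ-+ (r₁₁ ℕ.+ r₁₀) r₀₁) (cong (_+ fromℕ r₀₁) (fromℕ-+ r₁₁ r₁₀))) ⟩
            fromℕ c ∎
          where
          open ≡-Reasoning
          settled : ∀ {r} → r ≤ r₁₁ ⊔ r₁₀ ⊔ r₀₁ → fromℕ (m ⊓ r) ≡ fromℕ r
          settled r≤R = cong fromℕ (ℕP.m≥n⇒m⊓n≡n (ℕP.≤-trans r≤R R≤m))
        recurrence : ∀ m → r₁₁ ⊔ r₁₀ ⊔ r₀₁ ≤ m → s (suc m) ≡ (1ℚ + ¼ * fromℕ c) + ¼ * s m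
        recurrence m R≤m = trans (partialEpt-centre-suc m)
          (trans (cong (λ z → 1ℚ + ¼ * s m + ¼ * z) (branchSum-stable m R≤m)) (swap (s m) (fromℕ c)))
          where
          swap : ∀ S C → 1ℚ + ¼ * S + ¼ * C ≡ (1ℚ + ¼ * C) + ¼ * S
          swap = solve-∀ ℚ-ring
        fixed : (+ (8 ℕ.+ 2 ℕ.* c)) / 6 ≡ (1ℚ + ¼ * fromℕ c) + ¼ * ((+ (8 ℕ.+ 2 ℕ.* c)) / 6)
        fixed = begin
            (+ (8 ℕ.+ 2 ℕ.* c)) / 6
          ≡⟨ expand ⟩
            (fromℕ 8 + fromℕ 2 * fromℕ c) * ⅙
          ≡⟨ fixedPoint (fromℕ c) ⟩
            (1ℚ + ¼ * fromℕ c) + ¼ * ((fromℕ 8 + fromℕ 2 * fromℕ c) * ⅙)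
          ≡⟨ cong (λ z → (1ℚ + ¼ * fromℕ c) + ¼ * z) (sym expand) ⟩
            (1ℚ + ¼ * fromℕ c) + ¼ * ((+ (8 ℕ.+ 2 ℕ.* c)) / 6) ∎
          where
          open ≡-Reasoning
          expand : (+ (8 ℕ.+ 2 ℕ.* c)) / 6 ≡ (fromℕ 8 + fromℕ 2 * fromℕ c) * ⅙
          expand = trans (/6≡fromℕ*⅙ (8 ℕ.+ 2 ℕ.* c))
                         (cong (_* ⅙) (trans (fromℕ-+ 8 (2 ℕ.* c)) (cong (λ z → fromℕ 8 + z) (fromℕ-* 2 c))))
          fixedPoint : ∀ C → (fromℕ 8 + fromℕ 2 * C) * ⅙ ≡ (1ℚ + ¼ * C) + ¼ * ((fromℕ 8 + fromℕ 2 * C) * ⅙)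
          fixedPoint = solve-∀ ℚ-ring

open import Data.Integer using (+_)
open import Data.Nat using (_≤_; _<_; _∸_; _⊔_; _+_; _*_; _%_)
open import Data.Nat.DivMod using (m≡m%n+[m/n]*n; m*n%n≡0; [m+kn]%n≡m%n)
open import Data.Nat.Tactic.RingSolver using (solve-∀)
open import Data.Rational as ℚ using (ℚ; _/_)
open import Relation.Nullary.Decidable using (⌊_⌋)
open Limits
open Process
open PathProcess

spread : ℕ → ℕ → ℕ
spread v y = (v ⊔ y) + (v ⊔ suc y) + (suc v ⊔ y)

≤-by : ∀ {a b} d → a + d ≡ b → a ≤ b
≤-by {a} d refl = ℕP.m≤m+n a d

3[3+v+y]≤5+2spread : ∀ v y → 3 * (3 + v + y) ≤ 5 + 2 * spread v y
3[3+v+y]≤5+2spread v y with ℕP.<-cmp v y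
... | tri< v<y _ _ rewrite sym (ℕP.m+[n∸m]≡n v<y)
    | ℕP.m≤n⇒m⊔n≡n (ℕP.≤-trans (ℕP.n≤1+n v) (ℕP.m≤m+n (suc v) (y ∸ suc v)))
    | ℕP.m≤n⇒m⊔n≡n (ℕP.≤-trans (ℕP.n≤1+n v) (ℕP.≤-trans (ℕP.m≤m+n (suc v) (y ∸ suc v)) (ℕP.n≤1+n _)))
    | ℕP.m≤n⇒m⊔n≡n (ℕP.m≤m+n (suc v) (y ∸ suc v)) = ≤-by (3 * (y ∸ suc v) + 1) (arithmetic v (y ∸ suc v))
  where
  arithmetic : ∀ v d → 3 * (3 + v + (suc v + d)) + (3 * d + 1) ≡ 5 + 2 * ((suc v + d) + suc (suc v + d) + (suc v + d))
  arithmetic = solve-∀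
... | tri≈ _ refl _ rewrite ℕP.⊔-idem v | ℕP.m≤n⇒m⊔n≡n (ℕP.n≤1+n v) | ℕP.m≥n⇒m⊔n≡m (ℕP.n≤1+n v) = ≤-by 0 (arithmetic v)
  where
  arithmetic : ∀ v → 3 * (3 + v + v) + 0 ≡ 5 + 2 * (v + suc v + suc v)
  arithmetic = solve-∀
... | tri> _ _ y<v rewrite sym (ℕP.m+[n∸m]≡n y<v)
    | ℕP.m≥n⇒m⊔n≡m (ℕP.≤-trans (ℕP.n≤1+n y) (ℕP.m≤m+n (suc y) (v ∸ suc y)))
    | ℕP.m≥n⇒m⊔n≡m (ℕP.m≤m+n (suc y) (v ∸ suc y))
    | ℕP.m≥n⇒m⊔n≡m (ℕP.≤-trans (ℕP.n≤1+n y) (ℕP.≤-trans (ℕP.m≤m+n (suc y) (v ∸ suc y)) (ℕP.n≤1+n _))) =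
  ≤-by (3 * (v ∸ suc y) + 1) (arithmetic y (v ∸ suc y))
  where
  arithmetic : ∀ y d → 3 * (3 + (suc y + d) + y) + (3 * d + 1) ≡ 5 + 2 * ((suc y + d) + (suc y + d) + suc (suc y + d))
  arithmetic = solve-∀

spread-suc : ∀ g → spread (suc g) g ≡ 3 * g + 4
spread-suc g rewrite ℕP.m≥n⇒m⊔n≡m (ℕP.n≤1+n g) | ℕP.⊔-idem (suc g) | ℕP.m≥n⇒m⊔n≡m (ℕP.m≤n⇒m≤1+n (ℕP.n≤1+n g)) =
  arithmetic g
  where
  arithmetic : ∀ g → suc g + suc g + suc (suc g) ≡ 3 * g + 4
  arithmetic = solve-∀

spread-diag : ∀ g → spread g g ≡ 3 * g + 2
spread-diag g rewrite ℕP.⊔-idem g | ℕP.m≤n⇒m⊔n≡n (ℕP.n≤1+n g) | ℕP.m≥n⇒m⊔n≡m (ℕP.n≤1+n g) = arithmetic g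
  where
  arithmetic : ∀ g → g + suc g + suc g ≡ 3 * g + 2
  arithmetic = solve-∀

∸≡suc∸suc : ∀ {m n} → m < n → n ∸ m ≡ suc (n ∸ suc m)
∸≡suc∸suc {zero} {suc n} _ = refl
∸≡suc∸suc {suc m} {suc n} m<n = ∸≡suc∸suc (ℕ.s<s⁻¹ m<n)

2*≢1+2* : ∀ a b → 2 * a ≢ 1 + 2 * b
2*≢1+2* a b 2a≡1+2b = ℕP.0≢1+n (begin
    0                 ≡⟨ sym (m*n%n≡0 a 2) ⟩
    (a * 2) % 2       ≡⟨ cong (_% 2) (trans (ℕP.*-comm a 2) (trans 2a≡1+2b (cong (λ k → 1 + k) (ℕP.*-comm 2 b)))) ⟩
    (1 + b * 2) % 2   ≡⟨ [m+kn]%n≡m%n 1 b 2 ⟩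
    1                 ∎)
  where open ≡-Reasoning

even-form : ∀ n → 2 < n → n % 2 ≡ 0 → ∃ λ g → n ≡ 4 + 2 * g
even-form n 2<n n%2≡0 = halves (n ℕ./ 2) (trans (m≡m%n+[m/n]*n n 2) (cong (_+ n ℕ./ 2 * 2) n%2≡0)) 2<n
  where
  halves : ∀ {m} h → m ≡ h * 2 → 2 < m → ∃ λ g → m ≡ 4 + 2 * g
  halves zero refl ()
  halves (suc zero) refl (s≤s (s≤s ()))
  halves (suc (suc g)) m≡ _ = g , trans m≡ (double g)
    where
    double : ∀ g → suc (suc g) * 2 ≡ 4 + 2 * g
    double = solve-∀

odd-form : ∀ n → 2 < n → n % 2 ≡ 1 → ∃ λ g → n ≡ 3 + 2 * g
odd-form n 2<n n%2≡1 = halves (n ℕ./ 2) (trans (m≡m%n+[m/n]*n n 2) (cong (_+ n ℕ./ 2 * 2) n%2≡1)) 2<n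
  where
  halves : ∀ {m} h → m ≡ 1 + h * 2 → 2 < m → ∃ λ g → m ≡ 3 + 2 * g
  halves zero refl (s≤s ())
  halves (suc g) m≡ _ = g , trans m≡ (double g)
    where
    double : ∀ g → 1 + suc g * 2 ≡ 3 + 2 * g
    double = solve-∀

module Ept (n : ℕ) where
  open Path n

  singleton≡interval : ∀ u → singleton u ≡ interval (toℕ u) (toℕ u)
  singleton≡interval u = VP.tabulate-cong point
    where
    point : ∀ i → ⌊ i F.≟ u ⌋ ≡ inInterval (toℕ u) (toℕ u) (toℕ i)
    point i with i F.≟ u
    ... | yes refl = sym (inInterval-true {toℕ i} {toℕ i} ℕP.≤-refl ℕP.≤-refl)
    ... | no i≢u with ℕP.<-cmp (toℕ i) (toℕ u)
    ...   | tri< i<u _ _ = sym (inInterval-outside (inj₁ i<u))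
    ...   | tri≈ _ i≡u _ = ⊥-elim (i≢u (FP.toℕ-injective i≡u))
    ...   | tri> _ _ u<i = sym (inInterval-outside {toℕ u} (inj₂ u<i))

  6×ept-centre : ∀ v → suc (suc v) < n → ℕ
  6×ept-centre v v+2<n = 8 + 2 * Centre.c v v+2<n

  c≡spread : ∀ v (v+2<n : suc (suc v) < n) y → 3 + v + y ≡ n → Centre.c v v+2<n ≡ spread v y
  c≡spread v v+2<n y n≡ =
    cong₂ (λ z w → (v ⊔ z) + (v ⊔ w) + (suc v ⊔ z)) gap (trans (∸≡suc∸suc v+2<n) (cong suc gap))
    where
    gap : n ∸ (3 + v) ≡ y
    gap = trans (cong (_∸ (3 + v)) (sym n≡)) (ℕP.m+n∸m≡n (3 + v) y)

  3n≤5+2c : ∀ v v+2<n → 3 * n ≤ 5 + 2 * Centre.c v v+2<n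
  3n≤5+2c v v+2<n = subst₂ (λ m s → 3 * m ≤ 5 + 2 * s) n≡ (sym (c≡spread v v+2<n y n≡)) (3[3+v+y]≤5+2spread v y)
    where
    y = n ∸ (3 + v)
    n≡ : 3 + v + y ≡ n
    n≡ = ℕP.m+[n∸m]≡n v+2<n

  6×ept-centre-spread : ∀ v (v+2<n : suc (suc v) < n) y → 3 + v + y ≡ n → 6×ept-centre v v+2<n ≡ 8 + 2 * spread v y
  6×ept-centre-spread v v+2<n y n≡ = cong (λ c → 8 + 2 * c) (c≡spread v v+2<n y n≡)

  3n+3≤6×ept-centre : ∀ v v+2<n → 3 * n + 3 ≤ 6×ept-centre v v+2<n
  3n+3≤6×ept-centre v v+2<n = subst (_≤ 3 + (5 + 2 * Centre.c v v+2<n)) (ℕP.+-comm 3 (3 * n))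
    (ℕP.+-monoʳ-≤ 3 (3n≤5+2c v v+2<n))

  3n+4≤6×ept-centre : (∀ c → 3 * n ≢ 5 + 2 * c) → ∀ v v+2<n → 3 * n + 4 ≤ 6×ept-centre v v+2<n
  3n+4≤6×ept-centre parity v v+2<n = subst (_≤ 3 + (5 + 2 * Centre.c v v+2<n)) (ℕP.+-comm 4 (3 * n))
    (ℕP.+-monoʳ-≤ 3 (ℕP.≤∧≢⇒< (3n≤5+2c v v+2<n) (parity (Centre.c v v+2<n))))

  endpoint-atLeast : ∀ x → x ≤ 6 * (n ∸ 1) → ∀ {t} → SureGrowth t t → roundsLeft t t ≡ n ∸ 1 →
    EventuallyAtLeast (partialEpt adj (interval t t)) ((+ x) / 6)
  endpoint-atLeast x x≤end growth rounds≡ = converges⇒eventuallyAtLeast _ _ (ept-sureGrowth growth)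
    (subst (ℚ._≤_ ((+ x) / 6)) (sym (trans (cong fromℕ rounds≡) (fromℕ≡6*/6 (n ∸ 1)))) (/6-mono-≤ x≤end))

  ept-atLeast : ∀ x → x ≤ 6 * (n ∸ 1) → (∀ v v+2<n → x ≤ 6×ept-centre v v+2<n) →
    ∀ t → t < n → EventuallyAtLeast (partialEpt adj (interval t t)) ((+ x) / 6)
  ept-atLeast x x≤end x≤centre zero 0<n =
    endpoint-atLeast x x≤end (record { a≤b = z≤n ; a<n = 0<n ; shape = inj₂ (inj₁ refl) }) refl
  ept-atLeast x x≤end x≤centre (suc t) t+1<n with suc (suc t) ℕP.<? n
  ... | yes t+2<n = converges⇒eventuallyAtLeast _ _ (Centre.ept-centre t t+2<n) (/6-mono-≤ (x≤centre t t+2<n))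
  ... | no t+2≮n =
    endpoint-atLeast x x≤end (record { a≤b = ℕP.≤-refl ; a<n = t+1<n ; shape = inj₂ (inj₂ n≤t+2) })
      (trans (cong (suc t ⊔_) (ℕP.m≤n⇒m∸n≡0 n≤t+2))
             (trans (ℕP.⊔-identityʳ (suc t)) (cong (_∸ 1) (ℕP.≤-antisym t+1<n n≤t+2))))
    where
    n≤t+2 : n ≤ suc (suc t)
    n≤t+2 = ℕP.≮⇒≥ t+2≮n

  Ept≡-criterion : ∀ x → x ≤ 6 * (n ∸ 1) → (∀ v v+2<n → x ≤ 6×ept-centre v v+2<n) →
    (∃₂ λ v v+2<n → 6×ept-centre v v+2<n ≡ x) → Ept≡ adj ((+ x) / 6)
  Ept≡-criterion x x≤end x≤centre (v , v+2<n , value≡x) =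
    (centre , subst₂ (EptFrom≡ adj) (sym (trans (singleton≡interval centre) (cong (λ t → interval t t) centre≡)))
                                    (cong (λ z → (+ z) / 6) value≡x) (Centre.ept-centre v v+2<n))
    , λ u → subst (λ Z → EventuallyAtLeast (partialEpt adj Z) ((+ x) / 6)) (sym (singleton≡interval u))
                  (ept-atLeast x x≤end x≤centre (toℕ u) (FP.toℕ<n u))
    where open Centre v v+2<n using (centre; centre≡)

ept-even : ∀ g → Ept≡ (pathAdj (4 + 2 * g)) ((+ (3 * (4 + 2 * g) + 4)) / 6)
ept-even g = Ept≡-criterion (3 * n + 4) (≤-by (6 * g + 2) (end g)) (3n+4≤6×ept-centre parity)
               (suc g , v+2<n , trans (6×ept-centre-spread (suc g) v+2<n g (size g))
                                      (trans (cong (λ s → 8 + 2 * s) (spread-suc g)) (value g)))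
  where
  n = 4 + 2 * g
  open Ept n
  v+2<n : 3 + suc g ≤ n
  v+2<n = ℕP.+-monoʳ-≤ 4 (ℕP.m≤m+n g (g + 0))
  parity : ∀ c → 3 * n ≢ 5 + 2 * c
  parity c e = 2*≢1+2* (6 + 3 * g) (2 + c) (trans (double g) (trans e (odd c)))
    where
    double : ∀ g → 2 * (6 + 3 * g) ≡ 3 * (4 + 2 * g)
    double = solve-∀
    odd : ∀ c → 5 + 2 * c ≡ 1 + 2 * (2 + c)
    odd = solve-∀
  end : ∀ g → 3 * (4 + 2 * g) + 4 + (6 * g + 2) ≡ 6 * (3 + 2 * g)
  end = solve-∀
  size : ∀ g → 3 + suc g + g ≡ 4 + 2 * g
  size = solve-∀
  value : ∀ g → 8 + 2 * (3 * g + 4) ≡ 3 * (4 + 2 * g) + 4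
  value = solve-∀

ept-odd : ∀ g → Ept≡ (pathAdj (3 + 2 * g)) ((+ (3 * (3 + 2 * g) + 3)) / 6)
ept-odd g = Ept≡-criterion (3 * n + 3) (≤-by (6 * g) (end g)) 3n+3≤6×ept-centre
               (g , v+2<n , trans (6×ept-centre-spread g v+2<n g (size g))
                                  (trans (cong (λ s → 8 + 2 * s) (spread-diag g)) (value g)))
  where
  n = 3 + 2 * g
  open Ept n
  v+2<n : 3 + g ≤ n
  v+2<n = ℕP.+-monoʳ-≤ 3 (ℕP.m≤m+n g (g + 0))
  end : ∀ g → 3 * (3 + 2 * g) + 3 + 6 * g ≡ 6 * (2 + 2 * g)
  end = solve-∀
  size : ∀ g → 3 + g + g ≡ 3 + 2 * g
  size = solve-∀
  value : ∀ g → 8 + 2 * (3 * g + 2) ≡ 3 * (3 + 2 * g) + 3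
  value = solve-∀

proposition2p2 : (n : ℕ) → 2 < n →
    ((n % 2 ≡ 0 → Ept≡ (pathAdj n) ((+ (3 * n + 4)) / 6))
     × (n % 2 ≡ 1 → Ept≡ (pathAdj n) ((+ (3 * n + 3)) / 6)))
proposition2p2 n 2<n = even , odd
  where
  even : n % 2 ≡ 0 → Ept≡ (pathAdj n) ((+ (3 * n + 4)) / 6)
  even n-even with even-form n 2<n n-even
  ... | g , refl = ept-even g
  odd : n % 2 ≡ 1 → Ept≡ (pathAdj n) ((+ (3 * n + 3)) / 6)
  odd n-odd with odd-form n 2<n n-odd
  ... | g , refl = ept-odd g
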